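{- For every $w\in\mathfrak{h}'$, \[ \bar{\sigma}(w)=\sigma(w)+\varphi\Bigl(\frac{yT}{1+yT}z\ \tilde{*}\ \varphi(\sigma(w))\Bigr), \] where $\frac{yT}{1+yT}z=\sum_{j\ge1}(-1)^{j-1}T^jy^jz$.
   Context: Let $\mathfrak{h}=\mathbb{Q}\langle x,y\rangle$ (non-commutative polynomials) and $\mathfrak{h}'=y\mathfrak{h}\oplus x\mathfrak{h}$ (polynomials without constant term). Let $z=x+y$. Let $T$ be a formal variable; linear and bilinear maps are extended to power series in $T$ coefficientwise. $\sigma:\mathfrak{h}\to\mathfrak{h}[[T]]$ is the ring homomorphism with $\sigma(x)=x$, $\sigma(y)=y\sum_{n\ge0}x^nT^n$; $\tau:\mathfrak{h}\to\mathfrak{h}$ is the anti-automorphism with $\tau(x)=y$, $\tau(y)=x$; $\bar\sigma=\tau\circ\sigma\circ\tau$. $\varphi$ is the algebra automorphism of $\mathfrak{h}$ with $\varphi(x)=z$, $\varphi(y)=-y$. Put $e_0=x$, $e_1=-y$. The symmetric harmonic product $\tilde{*}:\mathfrak{h}'\times\mathfrak{h}'\to\mathfrak{h}'$ is the bilinear map defined by $e_a\,\tilde{*}\,e_{b_1}\cdots e_{b_n}=e_{b_1}\cdots e_{b_n}\,\tilde{*}\,e_a=e_{ab_1}\cdots e_{ab_n}$ and $e_aw_1\,\tilde{*}\,e_bw_2=e_{ab}(w_1\,\tilde{*}\,e_bw_2)+e_{ab}(e_aw_1\,\tilde{*}\,w_2)-e_{ab}e_0(w_1\,\tilde{*}\,w_2)$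 for $w_1,w_2\in\mathfrak{h}'$, $a,b,b_1,\dots,b_n\in\{0,1\}$ (products of indices $ab$ taken in $\{0,1\}$). -}

module Defs where

open import Data.Bool using (Bool; true; false; _∧_; not)
open import Data.List using (List; []; _∷_; _++_; map; concatMap; reverse; replicate)
open import Data.List.Properties using (≡-dec)
open import Data.Nat using (ℕ; zero; suc; _∸_)
open import Data.Product using (_×_; _,_)
open import Data.Rational using (ℚ; 0ℚ; 1ℚ; _+_; _*_; -_)
import Data.Bool as B
open import Relation.Nullary using (yes; no)
open import Relation.Binary.PropositionalEquality using (_≡_)

-- Words in the letters x, y:  false = x,  true = y.
-- (The same lists are also read as words in e_0, e_1:  false = e_0, true = e_1.)
Word : Set
Word = List Bool

-- An element of 𝔥 = ℚ⟨x,y⟩ as a formal finite ℚ-linear combination of words.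
Poly : Set
Poly = List (ℚ × Word)

coeff : Poly → Word → ℚ
coeff [] u = 0ℚ
coeff ((q , v) ∷ p) u with ≡-dec B._≟_ v u
... | yes _ = q + coeff p u
... | no _ = coeff p u

_≈_ : Poly → Poly → Set
p ≈ q = ∀ u → coeff p u ≡ coeff q u

infix 4 _≈_

scale : ℚ → Poly → Poly
scale c p = map (λ { (a , u) → (c * a , u) }) p

neg : Poly → Poly
neg = scale (- 1ℚ)

_⊗_ : Poly → Poly → Poly
p ⊗ q = concatMap (λ { (a , u) → map (λ { (b , v) → (a * b , u ++ v) }) q }) p

lin : (Word → Poly) → Poly → Poly
lin f p = concatMap (λ { (a , u) → scale a (f u) }) p

one : Poly
one = (1ℚ , []) ∷ []

-- Power series in T with coefficients in 𝔥: n ↦ coefficient of T^n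
Series : Set
Series = ℕ → Poly

sumUpTo : ℕ → (ℕ → Poly) → Poly
sumUpTo zero f = f zero
sumUpTo (suc n) f = sumUpTo n f ++ f (suc n)

_⊛_ : Series → Series → Series
(A ⊛ B) n = sumUpTo n (λ k → A k ⊗ B (n ∸ k))

constS : Poly → Series
constS p zero = p
constS p (suc n) = []

σL : Bool → Series
σL false = constS ((1ℚ , false ∷ []) ∷ [])
σL true n = (1ℚ , true ∷ replicate n false) ∷ []

σW : Word → Series
σW [] = constS one
σW (a ∷ w) = σL a ⊛ σW w

σ : Poly → Series
σ p n = lin (λ u → σW u n) p

τW : Word → Word
τW u = reverse (map not u)

τ : Poly → Poly
τ = lin (λ u → (1ℚ , τW u) ∷ [])

σbar : Poly → Series
σbar p n = τ (σ (τ p) n)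

φL : Bool → Poly
φL false = (1ℚ , false ∷ []) ∷ (1ℚ , true ∷ []) ∷ []
φL true = (- 1ℚ , true ∷ []) ∷ []

φW : Word → Poly
φW [] = one
φW (a ∷ w) = φL a ⊗ φW w

φ : Poly → Poly
φ = lin φW

φS : Series → Series
φS A n = φ (A n)

-- symmetric harmonic product on words in e_0, e_1 (false = e_0, true = e_1),
-- result a ℚ-combination of e-words; index product ab = a ∧ b.
-- (Only defined meaningfully on nonempty words, i.e. on 𝔥'; the empty word gives 0.)
prepend : Bool → Poly → Poly
prepend c = map (λ { (q , u) → (q , c ∷ u) })

hE : Word → Word → Poly
hE [] _ = []
hE (_ ∷ _) [] = []
hE (a ∷ []) v = (1ℚ , map (a ∧_) v) ∷ []
hE (a ∷ (c ∷ w1)) (b ∷ []) = (1ℚ , map (_∧ b) (a ∷ c ∷ w1)) ∷ []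
hE (a ∷ (c ∷ w1)) (b ∷ (d ∷ w2)) =
  prepend (a ∧ b) (hE (c ∷ w1) (b ∷ d ∷ w2))
  ++ prepend (a ∧ b) (hE (a ∷ c ∷ w1) (d ∷ w2))
  ++ neg (prepend (a ∧ b) (prepend false (hE (c ∷ w1) (d ∷ w2))))

-- sign relating an x/y-word and the e-word with the same letters (e_0 = x, e_1 = -y):
-- the x/y-word u equals eSign u times the e-word u
eSign : Word → ℚ
eSign [] = 1ℚ
eSign (false ∷ u) = eSign u
eSign (true ∷ u) = - (eSign u)

hW : Word → Word → Poly
hW u v = lin (λ r → (eSign r , r) ∷ []) (scale (eSign u * eSign v) (hE u v))

_⊛̃_ : Poly → Poly → Poly
p ⊛̃ q = concatMap (λ { (a , u) → concatMap (λ { (b , v) → scale (a * b) (hW u v) }) q }) p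

_⊛̃S_ : Series → Series → Series
(A ⊛̃S B) n = sumUpTo n (λ k → A k ⊛̃ B (n ∸ k))

sgnPow : ℕ → ℚ
sgnPow zero = 1ℚ
sgnPow (suc j) = - (sgnPow j)

yTz : Series
yTz zero = []
yTz (suc j) = (sgnPow j , replicate (suc j) true ++ false ∷ [])
            ∷ (sgnPow j , replicate (suc j) true ++ true ∷ []) ∷ []

_⊕S_ : Series → Series → Series
(A ⊕S B) n = A n ++ B n

{-# OPTIONS --safe #-}
module Submission where

open import Defs
open import Data.Bool using (Bool; true; false; _∧_; not)
open import Data.List using ([]; _∷_; _++_; _∷ʳ_; map; concatMap; reverse; replicate)
open import Data.List.Properties using (≡-dec; map-id; ++-assoc; ++-identityʳ; unfold-reverse; reverse-++; map-++)
open import Data.Nat using (ℕ; zero; suc; _∸_; _≤_; z≤n)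
open import Data.Nat.Properties using (n∸n≡0; ≤-refl; m≤n⇒m≤1+n; +-∸-assoc)
open import Data.Product using (_×_; _,_)
open import Data.Rational using (ℚ; 0ℚ; 1ℚ; _+_; _-_; _*_; -_)
import Data.Rational.Properties as ℚ
open import Data.Rational.Solver using (module +-*-Solver)
open import Algebra.Properties.Group ℚ.+-0-group using () renaming (⁻¹-involutive to neg-involutive)
open import Function using (_∘_)
open import Relation.Binary.PropositionalEquality
open import Relation.Nullary using (yes; no)
open ≡-Reasoning
open +-*-Solver
import Data.Bool as B

-- Equality in 𝔥 is tested against every linear functional g : Word → ℚ, so the proof works with
-- pairings ⟨ g ∣ p ⟩ instead of normal forms of polynomials. Read through φ in the basis e₀ = x,
-- e₁ = −y (the map Ψ), both sides obey first-letter recursions: σ(xw) = xσ(w),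
-- σ(yw) = y(1 − xT)⁻¹σ(w), σ̄(yw) = yσ̄(w) and σ̄(xw) = xσ̄(w) + yTσ̄(xw), the last two coming from
-- last-letter recursions of σ through τ. The harmonic product with e₁ᵏ(e₁ − e₀) satisfies a
-- matching recursion in its second factor, so induction on w (and on the power of T for a leading x)
-- gives Ψσ̄(w) = Ψσ(w) + yTz ⋆̃ Ψσ(w) in e-coordinates. As Ψ is φ up to the signs relating
-- x/y-words to e-words, and φ is an involution, this is the proposition.

pattern X = false
pattern Y = true

-- Pairing polynomials with linear functionals

infix 4 _≗ₚ_

⟨_∣_⟩ : (Word → ℚ) → Poly → ℚ
⟨ g ∣ [] ⟩ = 0ℚ
⟨ g ∣ (a , u) ∷ p ⟩ = a * g u + ⟨ g ∣ p ⟩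

_≗ₚ_ : Poly → Poly → Set
p ≗ₚ q = ∀ g → ⟨ g ∣ p ⟩ ≡ ⟨ g ∣ q ⟩

δ : Word → Word → ℚ
δ u v with ≡-dec B._≟_ v u
... | yes _ = 1ℚ
... | no _ = 0ℚ

coeff≡⟨δ∣⟩ : ∀ p u → coeff p u ≡ ⟨ δ u ∣ p ⟩
coeff≡⟨δ∣⟩ [] u = refl
coeff≡⟨δ∣⟩ ((q , v) ∷ p) u with ≡-dec B._≟_ v u
... | yes _ = cong₂ _+_ (sym (ℚ.*-identityʳ q)) (coeff≡⟨δ∣⟩ p u)
... | no _ = begin
  coeff p u              ≡⟨ coeff≡⟨δ∣⟩ p u ⟩
  ⟨ δ u ∣ p ⟩            ≡⟨ sym (ℚ.+-identityˡ _) ⟩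
  0ℚ + ⟨ δ u ∣ p ⟩       ≡⟨ cong (_+ ⟨ δ u ∣ p ⟩) (sym (ℚ.*-zeroʳ q)) ⟩
  q * 0ℚ + ⟨ δ u ∣ p ⟩   ∎

≗ₚ⇒≈ : ∀ {p q} → p ≗ₚ q → p ≈ q
≗ₚ⇒≈ {p} {q} p≗q u = begin
  coeff p u     ≡⟨ coeff≡⟨δ∣⟩ p u ⟩
  ⟨ δ u ∣ p ⟩   ≡⟨ p≗q (δ u) ⟩
  ⟨ δ u ∣ q ⟩   ≡⟨ sym (coeff≡⟨δ∣⟩ q u) ⟩
  coeff q u     ∎

⟨∣⟩-++ : ∀ g p q → ⟨ g ∣ p ++ q ⟩ ≡ ⟨ g ∣ p ⟩ + ⟨ g ∣ q ⟩
⟨∣⟩-++ g [] q = sym (ℚ.+-identityˡ _)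
⟨∣⟩-++ g ((a , u) ∷ p) q = begin
  a * g u + ⟨ g ∣ p ++ q ⟩              ≡⟨ cong (a * g u +_) (⟨∣⟩-++ g p q) ⟩
  a * g u + (⟨ g ∣ p ⟩ + ⟨ g ∣ q ⟩)     ≡⟨ sym (ℚ.+-assoc (a * g u) ⟨ g ∣ p ⟩ ⟨ g ∣ q ⟩) ⟩
  (a * g u + ⟨ g ∣ p ⟩) + ⟨ g ∣ q ⟩     ∎

⟨∣⟩-scale : ∀ g c p → ⟨ g ∣ scale c p ⟩ ≡ c * ⟨ g ∣ p ⟩
⟨∣⟩-scale g c [] = sym (ℚ.*-zeroʳ c)
⟨∣⟩-scale g c ((a , u) ∷ p) = begin
  c * a * g u + ⟨ g ∣ scale c p ⟩       ≡⟨ cong₂ _+_ (ℚ.*-assoc c a (g u)) (⟨∣⟩-scale g c p) ⟩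
  c * (a * g u) + c * ⟨ g ∣ p ⟩         ≡⟨ sym (ℚ.*-distribˡ-+ c _ _) ⟩
  c * (a * g u + ⟨ g ∣ p ⟩)             ∎

⟨∣⟩-neg : ∀ g p → ⟨ g ∣ neg p ⟩ ≡ - ⟨ g ∣ p ⟩
⟨∣⟩-neg g p = trans (⟨∣⟩-scale g (- 1ℚ) p) (solve 1 (λ e → con (- 1ℚ) :* e := :- e) refl ⟨ g ∣ p ⟩)

⟨∣⟩-prepend : ∀ g c p → ⟨ g ∣ prepend c p ⟩ ≡ ⟨ g ∘ (c ∷_) ∣ p ⟩
⟨∣⟩-prepend g c [] = refl
⟨∣⟩-prepend g c ((a , u) ∷ p) = cong (a * g (c ∷ u) +_) (⟨∣⟩-prepend g c p)

⟨∣⟩-singleton : ∀ g u → ⟨ g ∣ (1ℚ , u) ∷ [] ⟩ ≡ g u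
⟨∣⟩-singleton g u = trans (ℚ.+-identityʳ _) (ℚ.*-identityˡ _)

⟨∣⟩-map : ∀ g (h : ℚ × Word → ℚ × Word) c f → (∀ b v → h (b , v) ≡ (c * b , f v)) →
          ∀ q → ⟨ g ∣ map h q ⟩ ≡ c * ⟨ g ∘ f ∣ q ⟩
⟨∣⟩-map g h c f h≡ [] = sym (ℚ.*-zeroʳ c)
⟨∣⟩-map g h c f h≡ ((b , v) ∷ q) rewrite h≡ b v = begin
  c * b * g (f v) + ⟨ g ∣ map h q ⟩         ≡⟨ cong₂ _+_ (ℚ.*-assoc c b _) (⟨∣⟩-map g h c f h≡ q) ⟩
  c * (b * g (f v)) + c * ⟨ g ∘ f ∣ q ⟩     ≡⟨ sym (ℚ.*-distribˡ-+ c _ _) ⟩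
  c * (b * g (f v) + ⟨ g ∘ f ∣ q ⟩)         ∎

⟨∣⟩-concatMap : ∀ g (h : ℚ × Word → Poly) k → (∀ b v → ⟨ g ∣ h (b , v) ⟩ ≡ b * k v) →
                ∀ q → ⟨ g ∣ concatMap h q ⟩ ≡ ⟨ k ∣ q ⟩
⟨∣⟩-concatMap g h k h≡ [] = refl
⟨∣⟩-concatMap g h k h≡ ((b , v) ∷ q) = begin
  ⟨ g ∣ h (b , v) ++ concatMap h q ⟩          ≡⟨ ⟨∣⟩-++ g (h (b , v)) _ ⟩
  ⟨ g ∣ h (b , v) ⟩ + ⟨ g ∣ concatMap h q ⟩   ≡⟨ cong₂ _+_ (h≡ b v) (⟨∣⟩-concatMap g h k h≡ q) ⟩
  b * k v + ⟨ k ∣ q ⟩                          ∎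

⟨∣⟩-lin : ∀ g f p → ⟨ g ∣ lin f p ⟩ ≡ ⟨ (λ u → ⟨ g ∣ f u ⟩) ∣ p ⟩
⟨∣⟩-lin g f = ⟨∣⟩-concatMap g _ _ (λ b v → ⟨∣⟩-scale g b (f v))

⟨∣⟩-⊗ : ∀ g p q → ⟨ g ∣ p ⊗ q ⟩ ≡ ⟨ (λ u → ⟨ g ∘ (u ++_) ∣ q ⟩) ∣ p ⟩
⟨∣⟩-⊗ g p q = ⟨∣⟩-concatMap g _ _ (λ a u → ⟨∣⟩-map g _ a (u ++_) (λ _ _ → refl) q) p

⟨∣⟩-congˡ : ∀ {g h} → (∀ u → g u ≡ h u) → ∀ p → ⟨ g ∣ p ⟩ ≡ ⟨ h ∣ p ⟩
⟨∣⟩-congˡ g≗h [] = refl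
⟨∣⟩-congˡ g≗h ((a , u) ∷ p) = cong₂ _+_ (cong (a *_) (g≗h u)) (⟨∣⟩-congˡ g≗h p)

⟨0∣⟩ : ∀ p → ⟨ (λ _ → 0ℚ) ∣ p ⟩ ≡ 0ℚ
⟨0∣⟩ [] = refl
⟨0∣⟩ ((a , u) ∷ p) = trans (cong₂ _+_ (ℚ.*-zeroʳ a) (⟨0∣⟩ p)) (ℚ.+-identityʳ 0ℚ)

⟨+∣⟩ : ∀ g h p → ⟨ (λ u → g u + h u) ∣ p ⟩ ≡ ⟨ g ∣ p ⟩ + ⟨ h ∣ p ⟩
⟨+∣⟩ g h [] = sym (ℚ.+-identityʳ 0ℚ)
⟨+∣⟩ g h ((a , u) ∷ p) = trans (cong (a * (g u + h u) +_) (⟨+∣⟩ g h p))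
  (solve 5 (λ a s t G H → a :* (s :+ t) :+ (G :+ H) := (a :* s :+ G) :+ (a :* t :+ H))
         refl a (g u) (h u) ⟨ g ∣ p ⟩ ⟨ h ∣ p ⟩)

⟨neg∣⟩ : ∀ g p → ⟨ (λ u → - g u) ∣ p ⟩ ≡ - ⟨ g ∣ p ⟩
⟨neg∣⟩ g [] = refl
⟨neg∣⟩ g ((a , u) ∷ p) = trans (cong (a * (- g u) +_) (⟨neg∣⟩ g p))
  (solve 3 (λ a s G → a :* (:- s) :+ (:- G) := :- (a :* s :+ G)) refl a (g u) ⟨ g ∣ p ⟩)

⟨-∣⟩ : ∀ g h p → ⟨ (λ u → g u - h u) ∣ p ⟩ ≡ ⟨ g ∣ p ⟩ - ⟨ h ∣ p ⟩
⟨-∣⟩ g h p = trans (⟨+∣⟩ g (λ u → - h u) p) (cong (⟨ g ∣ p ⟩ +_) (⟨neg∣⟩ h p))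

⟨*∣⟩ : ∀ c g p → ⟨ (λ u → c * g u) ∣ p ⟩ ≡ c * ⟨ g ∣ p ⟩
⟨*∣⟩ c g [] = sym (ℚ.*-zeroʳ c)
⟨*∣⟩ c g ((a , u) ∷ p) = trans (cong (a * (c * g u) +_) (⟨*∣⟩ c g p))
  (solve 4 (λ c a s G → a :* (c :* s) :+ c :* G := c :* (a :* s :+ G)) refl c a (g u) ⟨ g ∣ p ⟩)

⟨∣⟩-swap : ∀ (F : Word → Word → ℚ) p q →
           ⟨ (λ u → ⟨ F u ∣ q ⟩) ∣ p ⟩ ≡ ⟨ (λ v → ⟨ (λ u → F u v) ∣ p ⟩) ∣ q ⟩
⟨∣⟩-swap F [] q = sym (⟨0∣⟩ q)
⟨∣⟩-swap F ((a , u) ∷ p) q = begin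
  a * ⟨ F u ∣ q ⟩ + ⟨ (λ u′ → ⟨ F u′ ∣ q ⟩) ∣ p ⟩
    ≡⟨ cong₂ _+_ (sym (⟨*∣⟩ a (F u) q)) (⟨∣⟩-swap F p q) ⟩
  ⟨ (λ v → a * F u v) ∣ q ⟩ + ⟨ (λ v → ⟨ (λ u′ → F u′ v) ∣ p ⟩) ∣ q ⟩
    ≡⟨ sym (⟨+∣⟩ (λ v → a * F u v) _ q) ⟩
  ⟨ (λ v → a * F u v + ⟨ (λ u′ → F u′ v) ∣ p ⟩) ∣ q ⟩
    ∎

∑ : ℕ → (ℕ → ℚ) → ℚ
∑ zero f = f 0
∑ (suc n) f = ∑ n f + f (suc n)

∑-cong : ∀ n {f h} → (∀ k → k ≤ n → f k ≡ h k) → ∑ n f ≡ ∑ n h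
∑-cong zero f≗h = f≗h 0 z≤n
∑-cong (suc n) f≗h = cong₂ _+_ (∑-cong n (λ k k≤n → f≗h k (m≤n⇒m≤1+n k≤n))) (f≗h (suc n) ≤-refl)

∑-0 : ∀ n → ∑ n (λ _ → 0ℚ) ≡ 0ℚ
∑-0 zero = refl
∑-0 (suc n) = trans (cong (_+ 0ℚ) (∑-0 n)) (ℚ.+-identityʳ 0ℚ)

∑-+ : ∀ n f h → ∑ n (λ k → f k + h k) ≡ ∑ n f + ∑ n h
∑-+ zero f h = refl
∑-+ (suc n) f h = trans (cong (_+ (f (suc n) + h (suc n))) (∑-+ n f h))
  (solve 4 (λ F H a b → (F :+ H) :+ (a :+ b) := (F :+ a) :+ (H :+ b)) refl (∑ n f) (∑ n h) (f (suc n)) (h (suc n)))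

∑-neg : ∀ n f → ∑ n (λ k → - f k) ≡ - ∑ n f
∑-neg zero f = refl
∑-neg (suc n) f = trans (cong (_+ - f (suc n)) (∑-neg n f)) (sym (ℚ.neg-distrib-+ (∑ n f) (f (suc n))))

∑-- : ∀ n f h → ∑ n (λ k → f k - h k) ≡ ∑ n f - ∑ n h
∑-- n f h = trans (∑-+ n f (λ k → - h k)) (cong (∑ n f +_) (∑-neg n h))

∑-suc-head : ∀ n f → ∑ (suc n) f ≡ f 0 + ∑ n (f ∘ suc)
∑-suc-head zero f = refl
∑-suc-head (suc n) f = trans (cong (_+ f (suc (suc n))) (∑-suc-head n f)) (ℚ.+-assoc (f 0) _ _)

∑-head-only : ∀ n f → (∀ k → f (suc k) ≡ 0ℚ) → ∑ n f ≡ f 0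
∑-head-only zero f _ = refl
∑-head-only (suc n) f tail≡0 = trans (cong₂ _+_ (∑-head-only n f tail≡0) (tail≡0 n)) (ℚ.+-identityʳ _)

∑-antidiagonal-suc : ∀ m (F : ℕ → ℕ → ℚ) →
  ∑ (suc m) (λ k → F k (suc m ∸ k)) ≡ ∑ m (λ k → F k (suc (m ∸ k))) + F (suc m) 0
∑-antidiagonal-suc m F =
  cong₂ _+_ (∑-cong m (λ k k≤m → cong (F k) (+-∸-assoc 1 k≤m))) (cong (F (suc m)) (n∸n≡0 m))

∑-antidiagonal-last : ∀ n (F : ℕ → ℕ → ℚ) → (∀ k m → F k (suc m) ≡ 0ℚ) → ∑ n (λ k → F k (n ∸ k)) ≡ F n 0
∑-antidiagonal-last zero F _ = refl
∑-antidiagonal-last (suc n) F F≡0 = begin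
  ∑ (suc n) (λ k → F k (suc n ∸ k))                ≡⟨ ∑-antidiagonal-suc n F ⟩
  ∑ n (λ k → F k (suc (n ∸ k))) + F (suc n) 0      ≡⟨ cong (_+ F (suc n) 0) (∑-cong n (λ k _ → F≡0 k (n ∸ k))) ⟩
  ∑ n (λ _ → 0ℚ) + F (suc n) 0                     ≡⟨ cong (_+ F (suc n) 0) (∑-0 n) ⟩
  0ℚ + F (suc n) 0                                 ≡⟨ ℚ.+-identityˡ _ ⟩
  F (suc n) 0                                      ∎

⟨∑∣⟩ : ∀ n (F : ℕ → Word → ℚ) p → ⟨ (λ u → ∑ n (λ k → F k u)) ∣ p ⟩ ≡ ∑ n (λ k → ⟨ F k ∣ p ⟩)
⟨∑∣⟩ zero F p = refl
⟨∑∣⟩ (suc n) F p =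
  trans (⟨+∣⟩ (λ u → ∑ n (λ k → F k u)) (F (suc n)) p) (cong (_+ ⟨ F (suc n) ∣ p ⟩) (⟨∑∣⟩ n F p))

⟨∣⟩-sumUpTo : ∀ g n F → ⟨ g ∣ sumUpTo n F ⟩ ≡ ∑ n (λ k → ⟨ g ∣ F k ⟩)
⟨∣⟩-sumUpTo g zero F = refl
⟨∣⟩-sumUpTo g (suc n) F =
  trans (⟨∣⟩-++ g (sumUpTo n F) (F (suc n))) (cong (_+ ⟨ g ∣ F (suc n) ⟩) (⟨∣⟩-sumUpTo g n F))

⟨∣⟩-monomial-⊗ : ∀ g u q → ⟨ g ∣ ((1ℚ , u) ∷ []) ⊗ q ⟩ ≡ ⟨ g ∘ (u ++_) ∣ q ⟩
⟨∣⟩-monomial-⊗ g u q = trans (⟨∣⟩-⊗ g ((1ℚ , u) ∷ []) q) (⟨∣⟩-singleton (λ u′ → ⟨ g ∘ (u′ ++_) ∣ q ⟩) u)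

-- First- and last-letter recursions of σ

σW-X∷ : ∀ w n g → ⟨ g ∣ σW (X ∷ w) n ⟩ ≡ ⟨ g ∘ (X ∷_) ∣ σW w n ⟩
σW-X∷ w n g = begin
  ⟨ g ∣ σW (X ∷ w) n ⟩                              ≡⟨ ⟨∣⟩-sumUpTo g n _ ⟩
  ∑ n (λ k → ⟨ g ∣ σL X k ⊗ σW w (n ∸ k) ⟩)        ≡⟨ ∑-head-only n _ (λ _ → refl) ⟩
  ⟨ g ∣ ((1ℚ , X ∷ []) ∷ []) ⊗ σW w n ⟩             ≡⟨ ⟨∣⟩-monomial-⊗ g (X ∷ []) (σW w n) ⟩
  ⟨ g ∘ (X ∷_) ∣ σW w n ⟩                           ∎

σW-Y∷ : ∀ w n g → ⟨ g ∣ σW (Y ∷ w) n ⟩ ≡ ∑ n (λ k → ⟨ g ∘ ((Y ∷ replicate k X) ++_) ∣ σW w (n ∸ k) ⟩)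
σW-Y∷ w n g =
  trans (⟨∣⟩-sumUpTo g n _) (∑-cong n (λ k _ → ⟨∣⟩-monomial-⊗ g (Y ∷ replicate k X) (σW w (n ∸ k))))

-- X*σW w is (1 − xT)⁻¹ σ(w), so that σ(y w) = y · X*σW w.
X*σW : Word → Series
X*σW w n = sumUpTo n (λ k → ((1ℚ , replicate k X) ∷ []) ⊗ σW w (n ∸ k))

⟨∣X*σW⟩ : ∀ w n g → ⟨ g ∣ X*σW w n ⟩ ≡ ∑ n (λ k → ⟨ g ∘ (replicate k X ++_) ∣ σW w (n ∸ k) ⟩)
⟨∣X*σW⟩ w n g =
  trans (⟨∣⟩-sumUpTo g n _) (∑-cong n (λ k _ → ⟨∣⟩-monomial-⊗ g (replicate k X) (σW w (n ∸ k))))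

σW-Y∷-X*σW : ∀ w n g → ⟨ g ∣ σW (Y ∷ w) n ⟩ ≡ ⟨ g ∘ (Y ∷_) ∣ X*σW w n ⟩
σW-Y∷-X*σW w n g = trans (σW-Y∷ w n g) (sym (⟨∣X*σW⟩ w n (g ∘ (Y ∷_))))

X*σW-zero : ∀ w → X*σW w 0 ≗ₚ σW w 0
X*σW-zero w g = ⟨∣X*σW⟩ w 0 g

X*σW-suc : ∀ w n g → ⟨ g ∣ X*σW w (suc n) ⟩ ≡ ⟨ g ∣ σW w (suc n) ⟩ + ⟨ g ∘ (X ∷_) ∣ X*σW w n ⟩
X*σW-suc w n g = begin
  ⟨ g ∣ X*σW w (suc n) ⟩   ≡⟨ ⟨∣X*σW⟩ w (suc n) g ⟩
  ∑ (suc n) (λ k → ⟨ g ∘ (replicate k X ++_) ∣ σW w (suc n ∸ k) ⟩)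
                           ≡⟨ ∑-suc-head n _ ⟩
  ⟨ g ∣ σW w (suc n) ⟩ + ∑ n (λ k → ⟨ g ∘ (X ∷_) ∘ (replicate k X ++_) ∣ σW w (n ∸ k) ⟩)
                           ≡⟨ cong (⟨ g ∣ σW w (suc n) ⟩ +_) (sym (⟨∣X*σW⟩ w n (g ∘ (X ∷_)))) ⟩
  ⟨ g ∣ σW w (suc n) ⟩ + ⟨ g ∘ (X ∷_) ∣ X*σW w n ⟩ ∎

⟨∣⟩-prefix-suffix : ∀ g p a q → ⟨ g ∘ (p ++_) ∘ (_∷ʳ a) ∣ q ⟩ ≡ ⟨ g ∘ (_∷ʳ a) ∘ (p ++_) ∣ q ⟩
⟨∣⟩-prefix-suffix g p a = ⟨∣⟩-congˡ (λ v → cong g (sym (++-assoc p v (a ∷ []))))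

replicate-∷ʳ : ∀ n (a : Bool) → replicate n a ∷ʳ a ≡ a ∷ replicate n a
replicate-∷ʳ zero a = refl
replicate-∷ʳ (suc n) a = cong (a ∷_) (replicate-∷ʳ n a)

σW-Y : ∀ n g → ⟨ g ∣ σW (Y ∷ []) n ⟩ ≡ g (Y ∷ replicate n X)
σW-Y n g = begin
  ⟨ g ∣ σW (Y ∷ []) n ⟩                     ≡⟨ σW-Y∷ [] n g ⟩
  ∑ n (λ k → ⟨ G k ∣ σW [] (n ∸ k) ⟩)       ≡⟨ ∑-antidiagonal-last n (λ k m → ⟨ G k ∣ σW [] m ⟩) (λ _ _ → refl) ⟩
  ⟨ G n ∣ one ⟩                             ≡⟨ ⟨∣⟩-singleton (G n) [] ⟩
  g (Y ∷ replicate n X ++ [])               ≡⟨ cong (g ∘ (Y ∷_)) (++-identityʳ (replicate n X)) ⟩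
  g (Y ∷ replicate n X)                     ∎
  where
  G : ℕ → Word → ℚ
  G k = g ∘ ((Y ∷ replicate k X) ++_)

σW-∷ʳX : ∀ u n g → ⟨ g ∣ σW (u ∷ʳ X) n ⟩ ≡ ⟨ g ∘ (_∷ʳ X) ∣ σW u n ⟩
σW-∷ʳX [] zero g = σW-X∷ [] 0 g
σW-∷ʳX [] (suc n) g = σW-X∷ [] (suc n) g
σW-∷ʳX (X ∷ u) n g = begin
  ⟨ g ∣ σW (X ∷ u ∷ʳ X) n ⟩               ≡⟨ σW-X∷ (u ∷ʳ X) n g ⟩
  ⟨ g ∘ (X ∷_) ∣ σW (u ∷ʳ X) n ⟩          ≡⟨ σW-∷ʳX u n (g ∘ (X ∷_)) ⟩
  ⟨ g ∘ (X ∷_) ∘ (_∷ʳ X) ∣ σW u n ⟩       ≡⟨ sym (σW-X∷ u n (g ∘ (_∷ʳ X))) ⟩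
  ⟨ g ∘ (_∷ʳ X) ∣ σW (X ∷ u) n ⟩          ∎
σW-∷ʳX (Y ∷ u) n g = begin
  ⟨ g ∣ σW (Y ∷ u ∷ʳ X) n ⟩
    ≡⟨ σW-Y∷ (u ∷ʳ X) n g ⟩
  ∑ n (λ k → ⟨ G k ∣ σW (u ∷ʳ X) (n ∸ k) ⟩)
    ≡⟨ ∑-cong n (λ k _ → trans (σW-∷ʳX u (n ∸ k) (G k))
                               (⟨∣⟩-prefix-suffix g (Y ∷ replicate k X) X (σW u (n ∸ k)))) ⟩
  ∑ n (λ k → ⟨ g ∘ (_∷ʳ X) ∘ ((Y ∷ replicate k X) ++_) ∣ σW u (n ∸ k) ⟩)
    ≡⟨ sym (σW-Y∷ u n (g ∘ (_∷ʳ X))) ⟩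
  ⟨ g ∘ (_∷ʳ X) ∣ σW (Y ∷ u) n ⟩
    ∎
  where
  G : ℕ → Word → ℚ
  G k = g ∘ ((Y ∷ replicate k X) ++_)

σW-∷ʳY-zero : ∀ u g → ⟨ g ∣ σW (u ∷ʳ Y) 0 ⟩ ≡ ⟨ g ∘ (_∷ʳ Y) ∣ σW u 0 ⟩
σW-∷ʳY-zero [] g = trans (σW-Y 0 g) (sym (⟨∣⟩-singleton (g ∘ (_∷ʳ Y)) []))
σW-∷ʳY-zero (X ∷ u) g =
  trans (σW-X∷ (u ∷ʳ Y) 0 g) (trans (σW-∷ʳY-zero u (g ∘ (X ∷_))) (sym (σW-X∷ u 0 (g ∘ (_∷ʳ Y)))))
σW-∷ʳY-zero (Y ∷ u) g =
  trans (σW-Y∷ (u ∷ʳ Y) 0 g) (trans (σW-∷ʳY-zero u (g ∘ (Y ∷_))) (sym (σW-Y∷ u 0 (g ∘ (_∷ʳ Y)))))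

σW-∷ʳY-suc : ∀ u n g →
  ⟨ g ∣ σW (u ∷ʳ Y) (suc n) ⟩ ≡ ⟨ g ∘ (_∷ʳ Y) ∣ σW u (suc n) ⟩ + ⟨ g ∘ (_∷ʳ X) ∣ σW (u ∷ʳ Y) n ⟩
σW-∷ʳY-suc [] n g = begin
  ⟨ g ∣ σW (Y ∷ []) (suc n) ⟩                  ≡⟨ σW-Y (suc n) g ⟩
  g (Y ∷ X ∷ replicate n X)                    ≡⟨ cong (g ∘ (Y ∷_)) (sym (replicate-∷ʳ n X)) ⟩
  g (Y ∷ replicate n X ∷ʳ X)                   ≡⟨ sym (σW-Y n (g ∘ (_∷ʳ X))) ⟩
  ⟨ g ∘ (_∷ʳ X) ∣ σW (Y ∷ []) n ⟩              ≡⟨ sym (ℚ.+-identityˡ _) ⟩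
  0ℚ + ⟨ g ∘ (_∷ʳ X) ∣ σW (Y ∷ []) n ⟩         ∎
σW-∷ʳY-suc (X ∷ u) n g = begin
  ⟨ g ∣ σW (X ∷ u ∷ʳ Y) (suc n) ⟩
    ≡⟨ σW-X∷ (u ∷ʳ Y) (suc n) g ⟩
  ⟨ g ∘ (X ∷_) ∣ σW (u ∷ʳ Y) (suc n) ⟩
    ≡⟨ σW-∷ʳY-suc u n (g ∘ (X ∷_)) ⟩
  ⟨ g ∘ (X ∷_) ∘ (_∷ʳ Y) ∣ σW u (suc n) ⟩ + ⟨ g ∘ (X ∷_) ∘ (_∷ʳ X) ∣ σW (u ∷ʳ Y) n ⟩
    ≡⟨ sym (cong₂ _+_ (σW-X∷ u (suc n) (g ∘ (_∷ʳ Y))) (σW-X∷ (u ∷ʳ Y) n (g ∘ (_∷ʳ X)))) ⟩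
  ⟨ g ∘ (_∷ʳ Y) ∣ σW (X ∷ u) (suc n) ⟩ + ⟨ g ∘ (_∷ʳ X) ∣ σW (X ∷ u ∷ʳ Y) n ⟩
    ∎
σW-∷ʳY-suc (Y ∷ u) n g = begin
  ⟨ g ∣ σW (Y ∷ u ∷ʳ Y) (suc n) ⟩
    ≡⟨ σW-Y∷ (u ∷ʳ Y) (suc n) g ⟩
  ∑ (suc n) (λ k → ⟨ G k ∣ σW (u ∷ʳ Y) (suc n ∸ k) ⟩)
    ≡⟨ ∑-antidiagonal-suc n (λ k m → ⟨ G k ∣ σW (u ∷ʳ Y) m ⟩) ⟩
  ∑ n (λ k → ⟨ G k ∣ σW (u ∷ʳ Y) (suc (n ∸ k)) ⟩) + ⟨ G (suc n) ∣ σW (u ∷ʳ Y) 0 ⟩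
    ≡⟨ cong₂ _+_ (∑-cong n (λ k _ → σW-∷ʳY-suc u (n ∸ k) (G k))) (σW-∷ʳY-zero u (G (suc n))) ⟩
  ∑ n (λ k → Gʸ k (suc (n ∸ k)) + Gˣ k (n ∸ k)) + Gʸ (suc n) 0
    ≡⟨ cong (_+ Gʸ (suc n) 0) (∑-+ n _ _) ⟩
  (∑ n (λ k → Gʸ k (suc (n ∸ k))) + ∑ n (λ k → Gˣ k (n ∸ k))) + Gʸ (suc n) 0
    ≡⟨ solve 3 (λ a b c → (a :+ b) :+ c := (a :+ c) :+ b) refl
         (∑ n (λ k → Gʸ k (suc (n ∸ k)))) (∑ n (λ k → Gˣ k (n ∸ k))) (Gʸ (suc n) 0) ⟩
  (∑ n (λ k → Gʸ k (suc (n ∸ k))) + Gʸ (suc n) 0) + ∑ n (λ k → Gˣ k (n ∸ k))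
    ≡⟨ cong (_+ ∑ n (λ k → Gˣ k (n ∸ k))) (sym (∑-antidiagonal-suc n Gʸ)) ⟩
  ∑ (suc n) (λ k → Gʸ k (suc n ∸ k)) + ∑ n (λ k → Gˣ k (n ∸ k))
    ≡⟨ cong₂ _+_ (resum Y u (suc n)) (resum X (u ∷ʳ Y) n) ⟩
  ⟨ g ∘ (_∷ʳ Y) ∣ σW (Y ∷ u) (suc n) ⟩ + ⟨ g ∘ (_∷ʳ X) ∣ σW (Y ∷ u ∷ʳ Y) n ⟩
    ∎
  where
  G : ℕ → Word → ℚ
  G k = g ∘ ((Y ∷ replicate k X) ++_)
  Gʸ Gˣ : ℕ → ℕ → ℚ
  Gʸ k m = ⟨ G k ∘ (_∷ʳ Y) ∣ σW u m ⟩
  Gˣ k m = ⟨ G k ∘ (_∷ʳ X) ∣ σW (u ∷ʳ Y) m ⟩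
  resum : ∀ a v m → ∑ m (λ k → ⟨ G k ∘ (_∷ʳ a) ∣ σW v (m ∸ k) ⟩) ≡ ⟨ g ∘ (_∷ʳ a) ∣ σW (Y ∷ v) m ⟩
  resum a v m = sym (trans (σW-Y∷ v m (g ∘ (_∷ʳ a)))
    (∑-cong m (λ k _ → sym (⟨∣⟩-prefix-suffix g (Y ∷ replicate k X) a (σW v (m ∸ k))))))

⟨∣τ⟩ : ∀ g p → ⟨ g ∣ τ p ⟩ ≡ ⟨ g ∘ τW ∣ p ⟩
⟨∣τ⟩ g p = trans (⟨∣⟩-lin g (λ u → (1ℚ , τW u) ∷ []) p) (⟨∣⟩-congˡ (⟨∣⟩-singleton g ∘ τW) p)

τW-∷ : ∀ a w → τW (a ∷ w) ≡ τW w ∷ʳ not a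
τW-∷ a w = unfold-reverse (not a) (map not w)

τW-∷ʳ : ∀ v b → τW (v ∷ʳ b) ≡ not b ∷ τW v
τW-∷ʳ v b = trans (cong reverse (map-++ not v (b ∷ []))) (reverse-++ (map not v) (not b ∷ []))

σbarW : Word → Series
σbarW w n = τ (σW (τW w) n)

⟨∣σbarW-∷⟩ : ∀ a w n g → ⟨ g ∣ σbarW (a ∷ w) n ⟩ ≡ ⟨ g ∘ τW ∣ σW (τW w ∷ʳ not a) n ⟩
⟨∣σbarW-∷⟩ a w n g = trans (⟨∣τ⟩ g (σW (τW (a ∷ w)) n)) (cong (λ v → ⟨ g ∘ τW ∣ σW v n ⟩) (τW-∷ a w))

⟨∣τ⟩-∷ʳ : ∀ g b p → ⟨ g ∘ τW ∘ (_∷ʳ b) ∣ p ⟩ ≡ ⟨ g ∘ (not b ∷_) ∣ τ p ⟩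
⟨∣τ⟩-∷ʳ g b p = trans (⟨∣⟩-congˡ (λ v → cong g (τW-∷ʳ v b)) p) (sym (⟨∣τ⟩ (g ∘ (not b ∷_)) p))

σbarW-Y∷ : ∀ w n g → ⟨ g ∣ σbarW (Y ∷ w) n ⟩ ≡ ⟨ g ∘ (Y ∷_) ∣ σbarW w n ⟩
σbarW-Y∷ w n g = begin
  ⟨ g ∣ σbarW (Y ∷ w) n ⟩                 ≡⟨ ⟨∣σbarW-∷⟩ Y w n g ⟩
  ⟨ g ∘ τW ∣ σW (τW w ∷ʳ X) n ⟩           ≡⟨ σW-∷ʳX (τW w) n (g ∘ τW) ⟩
  ⟨ g ∘ τW ∘ (_∷ʳ X) ∣ σW (τW w) n ⟩      ≡⟨ ⟨∣τ⟩-∷ʳ g X (σW (τW w) n) ⟩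
  ⟨ g ∘ (Y ∷_) ∣ σbarW w n ⟩              ∎

σbarW-X∷-zero : ∀ w g → ⟨ g ∣ σbarW (X ∷ w) 0 ⟩ ≡ ⟨ g ∘ (X ∷_) ∣ σbarW w 0 ⟩
σbarW-X∷-zero w g = begin
  ⟨ g ∣ σbarW (X ∷ w) 0 ⟩                 ≡⟨ ⟨∣σbarW-∷⟩ X w 0 g ⟩
  ⟨ g ∘ τW ∣ σW (τW w ∷ʳ Y) 0 ⟩           ≡⟨ σW-∷ʳY-zero (τW w) (g ∘ τW) ⟩
  ⟨ g ∘ τW ∘ (_∷ʳ Y) ∣ σW (τW w) 0 ⟩      ≡⟨ ⟨∣τ⟩-∷ʳ g Y (σW (τW w) 0) ⟩
  ⟨ g ∘ (X ∷_) ∣ σbarW w 0 ⟩              ∎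

σbarW-X∷-suc : ∀ w n g →
  ⟨ g ∣ σbarW (X ∷ w) (suc n) ⟩ ≡ ⟨ g ∘ (X ∷_) ∣ σbarW w (suc n) ⟩ + ⟨ g ∘ (Y ∷_) ∣ σbarW (X ∷ w) n ⟩
σbarW-X∷-suc w n g = begin
  ⟨ g ∣ σbarW (X ∷ w) (suc n) ⟩
    ≡⟨ ⟨∣σbarW-∷⟩ X w (suc n) g ⟩
  ⟨ g ∘ τW ∣ σW (τW w ∷ʳ Y) (suc n) ⟩
    ≡⟨ σW-∷ʳY-suc (τW w) n (g ∘ τW) ⟩
  ⟨ g ∘ τW ∘ (_∷ʳ Y) ∣ σW (τW w) (suc n) ⟩ + ⟨ g ∘ τW ∘ (_∷ʳ X) ∣ σW (τW w ∷ʳ Y) n ⟩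
    ≡⟨ cong₂ _+_ (⟨∣τ⟩-∷ʳ g Y (σW (τW w) (suc n))) (⟨∣τ⟩-∷ʳ g X (σW (τW w ∷ʳ Y) n)) ⟩
  ⟨ g ∘ (X ∷_) ∣ σbarW w (suc n) ⟩ + ⟨ g ∘ (Y ∷_) ∣ τ (σW (τW w ∷ʳ Y) n) ⟩
    ≡⟨ cong (λ v → ⟨ g ∘ (X ∷_) ∣ σbarW w (suc n) ⟩ + ⟨ g ∘ (Y ∷_) ∣ τ (σW v n) ⟩) (sym (τW-∷ X w)) ⟩
  ⟨ g ∘ (X ∷_) ∣ σbarW w (suc n) ⟩ + ⟨ g ∘ (Y ∷_) ∣ σbarW (X ∷ w) n ⟩
    ∎

pattern e₀ = false
pattern e₁ = true

-- ΨW u is φ(u) written in the basis of e-words: φ(x) = e₀ − e₁ and φ(y) = e₁.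
ΨL : Bool → Poly
ΨL X = (1ℚ , e₀ ∷ []) ∷ (- 1ℚ , e₁ ∷ []) ∷ []
ΨL Y = (1ℚ , e₁ ∷ []) ∷ []

ΨW : Word → Poly
ΨW [] = one
ΨW (a ∷ w) = ΨL a ⊗ ΨW w

Ψ : Poly → Poly
Ψ = lin ΨW

Ψᵀ : (Word → ℚ) → Word → ℚ
Ψᵀ g u = ⟨ g ∣ ΨW u ⟩

⟨∣Ψ⟩ : ∀ g p → ⟨ g ∣ Ψ p ⟩ ≡ ⟨ Ψᵀ g ∣ p ⟩
⟨∣Ψ⟩ g = ⟨∣⟩-lin g ΨW

Ψᵀ-X∷ : ∀ g u → Ψᵀ g (X ∷ u) ≡ Ψᵀ (g ∘ (e₀ ∷_)) u - Ψᵀ (g ∘ (e₁ ∷_)) u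
Ψᵀ-X∷ g u = trans (⟨∣⟩-⊗ g (ΨL X) (ΨW u))
  (solve 2 (λ s t → con 1ℚ :* s :+ (con (- 1ℚ) :* t :+ con 0ℚ) := s :- t) refl
         (Ψᵀ (g ∘ (e₀ ∷_)) u) (Ψᵀ (g ∘ (e₁ ∷_)) u))

Ψᵀ-Y∷ : ∀ g u → Ψᵀ g (Y ∷ u) ≡ Ψᵀ (g ∘ (e₁ ∷_)) u
Ψᵀ-Y∷ g u = ⟨∣⟩-monomial-⊗ g (e₁ ∷ []) (ΨW u)

⟨Ψᵀ∘X∷∣⟩ : ∀ g p → ⟨ Ψᵀ g ∘ (X ∷_) ∣ p ⟩ ≡ ⟨ g ∘ (e₀ ∷_) ∣ Ψ p ⟩ - ⟨ g ∘ (e₁ ∷_) ∣ Ψ p ⟩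
⟨Ψᵀ∘X∷∣⟩ g p = begin
  ⟨ Ψᵀ g ∘ (X ∷_) ∣ p ⟩
    ≡⟨ ⟨∣⟩-congˡ (Ψᵀ-X∷ g) p ⟩
  ⟨ (λ u → Ψᵀ (g ∘ (e₀ ∷_)) u - Ψᵀ (g ∘ (e₁ ∷_)) u) ∣ p ⟩
    ≡⟨ ⟨-∣⟩ (Ψᵀ (g ∘ (e₀ ∷_))) (Ψᵀ (g ∘ (e₁ ∷_))) p ⟩
  ⟨ Ψᵀ (g ∘ (e₀ ∷_)) ∣ p ⟩ - ⟨ Ψᵀ (g ∘ (e₁ ∷_)) ∣ p ⟩
    ≡⟨ sym (cong₂ _-_ (⟨∣Ψ⟩ (g ∘ (e₀ ∷_)) p) (⟨∣Ψ⟩ (g ∘ (e₁ ∷_)) p)) ⟩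
  ⟨ g ∘ (e₀ ∷_) ∣ Ψ p ⟩ - ⟨ g ∘ (e₁ ∷_) ∣ Ψ p ⟩
    ∎

⟨Ψᵀ∘Y∷∣⟩ : ∀ g p → ⟨ Ψᵀ g ∘ (Y ∷_) ∣ p ⟩ ≡ ⟨ g ∘ (e₁ ∷_) ∣ Ψ p ⟩
⟨Ψᵀ∘Y∷∣⟩ g p = trans (⟨∣⟩-congˡ (Ψᵀ-Y∷ g) p) (sym (⟨∣Ψ⟩ (g ∘ (e₁ ∷_)) p))

Ψσ Ψσbar ΨX*σ : Word → Series
Ψσ w n = Ψ (σW w n)
Ψσbar w n = Ψ (σbarW w n)
ΨX*σ w n = Ψ (X*σW w n)

Ψσ-X∷ : ∀ w n g → ⟨ g ∣ Ψσ (X ∷ w) n ⟩ ≡ ⟨ g ∘ (e₀ ∷_) ∣ Ψσ w n ⟩ - ⟨ g ∘ (e₁ ∷_) ∣ Ψσ w n ⟩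
Ψσ-X∷ w n g = trans (⟨∣Ψ⟩ g (σW (X ∷ w) n)) (trans (σW-X∷ w n (Ψᵀ g)) (⟨Ψᵀ∘X∷∣⟩ g (σW w n)))

Ψσ-Y∷ : ∀ w n g → ⟨ g ∣ Ψσ (Y ∷ w) n ⟩ ≡ ⟨ g ∘ (e₁ ∷_) ∣ ΨX*σ w n ⟩
Ψσ-Y∷ w n g =
  trans (⟨∣Ψ⟩ g (σW (Y ∷ w) n)) (trans (σW-Y∷-X*σW w n (Ψᵀ g)) (⟨Ψᵀ∘Y∷∣⟩ g (X*σW w n)))

ΨX*σ-zero : ∀ w → ΨX*σ w 0 ≗ₚ Ψσ w 0
ΨX*σ-zero w g = trans (⟨∣Ψ⟩ g (X*σW w 0)) (trans (X*σW-zero w (Ψᵀ g)) (sym (⟨∣Ψ⟩ g (σW w 0))))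

ΨX*σ-suc : ∀ w n g → ⟨ g ∣ ΨX*σ w (suc n) ⟩ ≡
  ⟨ g ∣ Ψσ w (suc n) ⟩ + (⟨ g ∘ (e₀ ∷_) ∣ ΨX*σ w n ⟩ - ⟨ g ∘ (e₁ ∷_) ∣ ΨX*σ w n ⟩)
ΨX*σ-suc w n g = trans (⟨∣Ψ⟩ g (X*σW w (suc n))) (trans (X*σW-suc w n (Ψᵀ g))
  (cong₂ _+_ (sym (⟨∣Ψ⟩ g (σW w (suc n)))) (⟨Ψᵀ∘X∷∣⟩ g (X*σW w n))))

Ψσbar-Y∷ : ∀ w n g → ⟨ g ∣ Ψσbar (Y ∷ w) n ⟩ ≡ ⟨ g ∘ (e₁ ∷_) ∣ Ψσbar w n ⟩
Ψσbar-Y∷ w n g =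
  trans (⟨∣Ψ⟩ g (σbarW (Y ∷ w) n)) (trans (σbarW-Y∷ w n (Ψᵀ g)) (⟨Ψᵀ∘Y∷∣⟩ g (σbarW w n)))

Ψσbar-X∷-zero : ∀ w g → ⟨ g ∣ Ψσbar (X ∷ w) 0 ⟩ ≡ ⟨ g ∘ (e₀ ∷_) ∣ Ψσbar w 0 ⟩ - ⟨ g ∘ (e₁ ∷_) ∣ Ψσbar w 0 ⟩
Ψσbar-X∷-zero w g =
  trans (⟨∣Ψ⟩ g (σbarW (X ∷ w) 0)) (trans (σbarW-X∷-zero w (Ψᵀ g)) (⟨Ψᵀ∘X∷∣⟩ g (σbarW w 0)))

Ψσbar-X∷-suc : ∀ w n g → ⟨ g ∣ Ψσbar (X ∷ w) (suc n) ⟩ ≡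
  (⟨ g ∘ (e₀ ∷_) ∣ Ψσbar w (suc n) ⟩ - ⟨ g ∘ (e₁ ∷_) ∣ Ψσbar w (suc n) ⟩)
    + ⟨ g ∘ (e₁ ∷_) ∣ Ψσbar (X ∷ w) n ⟩
Ψσbar-X∷-suc w n g = trans (⟨∣Ψ⟩ g (σbarW (X ∷ w) (suc n))) (trans (σbarW-X∷-suc w n (Ψᵀ g))
  (cong₂ _+_ (⟨Ψᵀ∘X∷∣⟩ g (σbarW w (suc n))) (⟨Ψᵀ∘Y∷∣⟩ g (σbarW (X ∷ w) n))))

Ψσbar-[] : ∀ n → Ψσbar [] n ≗ₚ Ψσ [] n
Ψσbar-[] zero g = trans (⟨∣Ψ⟩ g (σbarW [] 0)) (trans (⟨∣τ⟩ (Ψᵀ g) one) (sym (⟨∣Ψ⟩ g one)))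
Ψσbar-[] (suc n) g = refl

⟨∣Ψσ-[]⟩ : ∀ g → g [] ≡ 0ℚ → ∀ n → ⟨ g ∣ Ψσ [] n ⟩ ≡ 0ℚ
⟨∣Ψσ-[]⟩ g g[]≡0 zero =
  trans (⟨∣Ψ⟩ g one) (trans (⟨∣⟩-singleton (Ψᵀ g) []) (trans (⟨∣⟩-singleton g []) g[]≡0))
⟨∣Ψσ-[]⟩ g g[]≡0 (suc n) = refl

-- The harmonic product with yᵏz

-- Hz k g v = ⟨ g ∣ e₁ᵏ(e₁ − e₀) ⋆̃ v ⟩ for k ≥ 1: up to sign, (yTz)ₖ ⋆̃ v read in e-coordinates.
Hz : ℕ → (Word → ℚ) → Word → ℚ
Hz zero g v = 0ℚ
Hz (suc k) g v = ⟨ g ∣ hE (e₁ ∷ replicate k e₁ ∷ʳ e₁) v ⟩ - ⟨ g ∣ hE (e₁ ∷ replicate k e₁ ∷ʳ e₀) v ⟩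

Hz-[] : ∀ k g → Hz k g [] ≡ 0ℚ
Hz-[] zero g = refl
Hz-[] (suc k) g = refl

⟨∣hE⟩-∷∷ : ∀ g a c u b d v → ⟨ g ∣ hE (a ∷ c ∷ u) (b ∷ d ∷ v) ⟩ ≡
  ⟨ g ∘ ((a ∧ b) ∷_) ∣ hE (c ∷ u) (b ∷ d ∷ v) ⟩ +
  (⟨ g ∘ ((a ∧ b) ∷_) ∣ hE (a ∷ c ∷ u) (d ∷ v) ⟩ - ⟨ g ∘ ((a ∧ b) ∷_) ∘ (e₀ ∷_) ∣ hE (c ∷ u) (d ∷ v) ⟩)
⟨∣hE⟩-∷∷ g a c u b d v = begin
  ⟨ g ∣ prepend ab P ++ prepend ab Q ++ neg (prepend ab (prepend e₀ R)) ⟩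
    ≡⟨ ⟨∣⟩-++ g (prepend ab P) _ ⟩
  ⟨ g ∣ prepend ab P ⟩ + ⟨ g ∣ prepend ab Q ++ neg (prepend ab (prepend e₀ R)) ⟩
    ≡⟨ cong (⟨ g ∣ prepend ab P ⟩ +_) (⟨∣⟩-++ g (prepend ab Q) _) ⟩
  ⟨ g ∣ prepend ab P ⟩ + (⟨ g ∣ prepend ab Q ⟩ + ⟨ g ∣ neg (prepend ab (prepend e₀ R)) ⟩)
    ≡⟨ cong₂ (λ s t → s + (⟨ g ∣ prepend ab Q ⟩ + t))
             (⟨∣⟩-prepend g ab P) (⟨∣⟩-neg g (prepend ab (prepend e₀ R))) ⟩
  ⟨ g ∘ (ab ∷_) ∣ P ⟩ + (⟨ g ∣ prepend ab Q ⟩ - ⟨ g ∣ prepend ab (prepend e₀ R) ⟩)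
    ≡⟨ cong₂ (λ s t → ⟨ g ∘ (ab ∷_) ∣ P ⟩ + (s - t)) (⟨∣⟩-prepend g ab Q)
             (trans (⟨∣⟩-prepend g ab (prepend e₀ R)) (⟨∣⟩-prepend (g ∘ (ab ∷_)) e₀ R)) ⟩
  ⟨ g ∘ (ab ∷_) ∣ P ⟩ + (⟨ g ∘ (ab ∷_) ∣ Q ⟩ - ⟨ g ∘ (ab ∷_) ∘ (e₀ ∷_) ∣ R ⟩)
    ∎
  where
  ab : Bool
  ab = a ∧ b
  P Q R : Poly
  P = hE (c ∷ u) (b ∷ d ∷ v)
  Q = hE (a ∷ c ∷ u) (d ∷ v)
  R = hE (c ∷ u) (d ∷ v)

⟨∣hE⟩-∷[] : ∀ g a u b → ⟨ g ∣ hE (a ∷ u) (b ∷ []) ⟩ ≡ g (map (_∧ b) (a ∷ u))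
⟨∣hE⟩-∷[] g a [] b = ⟨∣⟩-singleton g _
⟨∣hE⟩-∷[] g a (c ∷ u) b = ⟨∣⟩-singleton g _

-- At k = 0 the word e₁ᵏ(e₁ − e₀) has length one, and ⋆̃ follows its single-letter rule there.
Hz-boundary : ℕ → (Word → ℚ) → Bool → Word → ℚ
Hz-boundary zero g b w = g (b ∷ e₀ ∷ w) - g (b ∷ b ∷ w)
Hz-boundary (suc k) g b w = 0ℚ

Hz-suc-∷ : ∀ k g b w → Hz (suc k) g (b ∷ w) ≡
  ((Hz k (g ∘ (b ∷_)) (b ∷ w) + Hz (suc k) (g ∘ (b ∷_)) w) - Hz k (g ∘ (b ∷_) ∘ (e₀ ∷_)) w)
    - Hz-boundary k g b w
Hz-suc-∷ zero g b [] = trans (cong₂ _-_ (⟨∣⟩-singleton g (b ∷ b ∷ [])) (⟨∣⟩-singleton g (b ∷ e₀ ∷ [])))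
  (solve 2 (λ s t → s :- t := ((con 0ℚ :+ (con 0ℚ :- con 0ℚ)) :- con 0ℚ) :- (t :- s)) refl
         (g (b ∷ b ∷ [])) (g (b ∷ e₀ ∷ [])))
Hz-suc-∷ zero g b (d ∷ w) = begin
  Hz 1 g (b ∷ d ∷ w)
    ≡⟨ cong₂ _-_ (⟨∣hE⟩-∷∷ g e₁ e₁ [] b d w) (⟨∣hE⟩-∷∷ g e₁ e₀ [] b d w) ⟩
  (single g₁ (b ∷ d ∷ w) + (Q₁ - single g₁₀ (d ∷ w)))
    - (single g₀ (b ∷ d ∷ w) + (Q₀ - single g₀ (e₀ ∷ d ∷ w)))
    ≡⟨ cong₂ (λ s t → (s + (Q₁ - t)) - (p + (Q₀ - p)))
             (single-e₁ (g ∘ (b ∷_)) _) (single-e₁ (g ∘ (b ∷_) ∘ (e₀ ∷_)) _) ⟩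
  (g (b ∷ b ∷ d ∷ w) + (Q₁ - g (b ∷ e₀ ∷ d ∷ w))) - (p + (Q₀ - p))
    ≡⟨ solve 5 (λ s t q₁ q₀ p →
                  (s :+ (q₁ :- t)) :- (p :+ (q₀ :- p)) := ((con 0ℚ :+ (q₁ :- q₀)) :- con 0ℚ) :- (t :- s))
             refl (g (b ∷ b ∷ d ∷ w)) (g (b ∷ e₀ ∷ d ∷ w)) Q₁ Q₀ p ⟩
  ((0ℚ + Hz 1 (g ∘ (b ∷_)) (d ∷ w)) - 0ℚ) - Hz-boundary 0 g b (d ∷ w)
    ∎
  where
  single : (Word → ℚ) → Word → ℚ
  single h v = ⟨ h ∣ (1ℚ , v) ∷ [] ⟩
  single-e₁ : ∀ h v → single (h ∘ map (e₁ ∧_)) v ≡ h v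
  single-e₁ h v = trans (⟨∣⟩-singleton (h ∘ map (e₁ ∧_)) v) (cong h (map-id v))
  g₁ g₁₀ g₀ : Word → ℚ
  g₁ v = g (b ∷ map (e₁ ∧_) v)
  g₁₀ v = g (b ∷ e₀ ∷ map (e₁ ∧_) v)
  g₀ v = g (b ∷ map (e₀ ∧_) v)
  Q₁ Q₀ p : ℚ
  Q₁ = ⟨ g ∘ (b ∷_) ∣ hE (e₁ ∷ e₁ ∷ []) (d ∷ w) ⟩
  Q₀ = ⟨ g ∘ (b ∷_) ∣ hE (e₁ ∷ e₀ ∷ []) (d ∷ w) ⟩
  p = single g₀ (b ∷ d ∷ w)
Hz-suc-∷ (suc k) g b [] = begin
  Hz (suc (suc k)) g (b ∷ [])
    ≡⟨ cong₂ _-_ (⟨∣hE⟩-∷[] g e₁ (e₁ ∷ u e₁) b) (⟨∣hE⟩-∷[] g e₁ (e₁ ∷ u e₀) b) ⟩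
  s - t
    ≡⟨ solve 2 (λ s t → s :- t := ((s :- t :+ (con 0ℚ :- con 0ℚ)) :- (con 0ℚ :- con 0ℚ)) :- con 0ℚ) refl s t ⟩
  ((s - t + (0ℚ - 0ℚ)) - (0ℚ - 0ℚ)) - 0ℚ
    ≡⟨ cong (λ h → ((h + (0ℚ - 0ℚ)) - (0ℚ - 0ℚ)) - 0ℚ)
            (sym (cong₂ _-_ (⟨∣hE⟩-∷[] (g ∘ (b ∷_)) e₁ (u e₁) b) (⟨∣hE⟩-∷[] (g ∘ (b ∷_)) e₁ (u e₀) b))) ⟩
  ((Hz (suc k) (g ∘ (b ∷_)) (b ∷ []) + Hz (suc (suc k)) (g ∘ (b ∷_)) [])
      - Hz (suc k) (g ∘ (b ∷_) ∘ (e₀ ∷_)) [])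
    - Hz-boundary (suc k) g b []
    ∎
  where
  u : Bool → Word
  u c = replicate k e₁ ∷ʳ c
  s t : ℚ
  s = g (map (_∧ b) (e₁ ∷ e₁ ∷ u e₁))
  t = g (map (_∧ b) (e₁ ∷ e₁ ∷ u e₀))
Hz-suc-∷ (suc k) g b (d ∷ w) =
  trans (cong₂ _-_ (⟨∣hE⟩-∷∷ g e₁ e₁ (u e₁) b d w) (⟨∣hE⟩-∷∷ g e₁ e₁ (u e₀) b d w))
  (solve 6 (λ p₁ p₀ q₁ q₀ r₁ r₀ →
              (p₁ :+ (q₁ :- r₁)) :- (p₀ :+ (q₀ :- r₀)) := (((p₁ :- p₀) :+ (q₁ :- q₀)) :- (r₁ :- r₀)) :- con 0ℚ)
         refl (P e₁) (P e₀) (Q e₁) (Q e₀) (R e₁) (R e₀))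
  where
  u : Bool → Word
  u c = replicate k e₁ ∷ʳ c
  P Q R : Bool → ℚ
  P c = ⟨ g ∘ (b ∷_) ∣ hE (e₁ ∷ u c) (b ∷ d ∷ w) ⟩
  Q c = ⟨ g ∘ (b ∷_) ∣ hE (e₁ ∷ e₁ ∷ u c) (d ∷ w) ⟩
  R c = ⟨ g ∘ (b ∷_) ∘ (e₀ ∷_) ∣ hE (e₁ ∷ u c) (d ∷ w) ⟩

Hz-e₀∷ : ∀ k g v → Hz k g (e₀ ∷ v) ≡ Hz k (g ∘ (e₀ ∷_)) v
Hz-e₀∷ zero g v = refl
Hz-e₀∷ (suc k) g v = begin
  Hz (suc k) g (e₀ ∷ v)
    ≡⟨ Hz-suc-∷ k g e₀ v ⟩
  ((Hz k g₀ (e₀ ∷ v) + Hz (suc k) g₀ v) - Hz k g₀₀ v) - Hz-boundary k g e₀ v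
    ≡⟨ cong₂ (λ s t → ((s + Hz (suc k) g₀ v) - Hz k g₀₀ v) - t) (Hz-e₀∷ k g₀ v) (boundary≡0 k) ⟩
  ((Hz k g₀₀ v + Hz (suc k) g₀ v) - Hz k g₀₀ v) - 0ℚ
    ≡⟨ solve 2 (λ s t → ((s :+ t) :- s) :- con 0ℚ := t) refl (Hz k g₀₀ v) (Hz (suc k) g₀ v) ⟩
  Hz (suc k) g₀ v
    ∎
  where
  g₀ g₀₀ : Word → ℚ
  g₀ = g ∘ (e₀ ∷_)
  g₀₀ = g₀ ∘ (e₀ ∷_)
  boundary≡0 : ∀ k → Hz-boundary k g e₀ v ≡ 0ℚ
  boundary≡0 zero = ℚ.+-inverseʳ (g (e₀ ∷ e₀ ∷ v))
  boundary≡0 (suc k) = refl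

-- H⋆ V n g = ⟨ g ∣ (yTz ⋆̃ V)ₙ ⟩ in e-coordinates; H⋆e₁ is the same for e₁V in place of V.
H⋆ H⋆e₁ : Series → ℕ → (Word → ℚ) → ℚ
H⋆ V n g = ∑ n (λ k → ⟨ Hz k g ∣ V (n ∸ k) ⟩)
H⋆e₁ V n g = ∑ n (λ k → ⟨ Hz k g ∘ (e₁ ∷_) ∣ V (n ∸ k) ⟩)

H⋆-zero : ∀ V g → H⋆ V 0 g ≡ 0ℚ
H⋆-zero V g = ⟨0∣⟩ (V 0)

H⋆e₁-zero : ∀ V g → H⋆e₁ V 0 g ≡ 0ℚ
H⋆e₁-zero V g = ⟨0∣⟩ (V 0)

H⋆-Ψσ-[] : ∀ n g → H⋆ (Ψσ []) n g ≡ 0ℚ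
H⋆-Ψσ-[] n g = trans (∑-cong n (λ k _ → ⟨∣Ψσ-[]⟩ (Hz k g) (Hz-[] k g) (n ∸ k))) (∑-0 n)

∑-Hz∘e₀∷-Hz∘e₁∷ : ∀ V m h →
  ∑ m (λ k → ⟨ Hz k h ∘ (e₀ ∷_) ∣ V (m ∸ k) ⟩ - ⟨ Hz k h ∘ (e₁ ∷_) ∣ V (m ∸ k) ⟩) ≡ H⋆ V m (h ∘ (e₀ ∷_)) - H⋆e₁ V m h
∑-Hz∘e₀∷-Hz∘e₁∷ V m h =
  trans (∑-cong m (λ k _ → cong (_- ⟨ Hz k h ∘ (e₁ ∷_) ∣ V (m ∸ k) ⟩) (⟨∣⟩-congˡ (Hz-e₀∷ k h) (V (m ∸ k)))))
        (∑-- m (λ k → ⟨ Hz k (h ∘ (e₀ ∷_)) ∣ V (m ∸ k) ⟩) (λ k → ⟨ Hz k h ∘ (e₁ ∷_) ∣ V (m ∸ k) ⟩))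

H⋆-Ψσ-X∷ : ∀ w n g → H⋆ (Ψσ (X ∷ w)) n g ≡ H⋆ (Ψσ w) n (g ∘ (e₀ ∷_)) - H⋆e₁ (Ψσ w) n g
H⋆-Ψσ-X∷ w n g = trans (∑-cong n (λ k _ → Ψσ-X∷ w (n ∸ k) (Hz k g))) (∑-Hz∘e₀∷-Hz∘e₁∷ (Ψσ w) n g)

H⋆-Ψσ-Y∷ : ∀ w n g → H⋆ (Ψσ (Y ∷ w)) n g ≡ H⋆e₁ (ΨX*σ w) n g
H⋆-Ψσ-Y∷ w n g = ∑-cong n (λ k _ → Ψσ-Y∷ w (n ∸ k) (Hz k g))

⟨Hz∘e₁∷∣⟩-suc : ∀ k g P → ⟨ Hz (suc k) g ∘ (e₁ ∷_) ∣ P ⟩ ≡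
  ((⟨ Hz k (g ∘ (e₁ ∷_)) ∘ (e₁ ∷_) ∣ P ⟩ + ⟨ Hz (suc k) (g ∘ (e₁ ∷_)) ∣ P ⟩)
      - ⟨ Hz k (g ∘ (e₁ ∷_) ∘ (e₀ ∷_)) ∣ P ⟩)
    - ⟨ Hz-boundary k g e₁ ∣ P ⟩
⟨Hz∘e₁∷∣⟩-suc k g P = begin
  ⟨ Hz (suc k) g ∘ (e₁ ∷_) ∣ P ⟩
    ≡⟨ ⟨∣⟩-congˡ (Hz-suc-∷ k g e₁) P ⟩
  ⟨ (λ v → ((Hz k g₁ (e₁ ∷ v) + Hz (suc k) g₁ v) - Hz k g₁₀ v) - Hz-boundary k g e₁ v) ∣ P ⟩
    ≡⟨ ⟨-∣⟩ _ (Hz-boundary k g e₁) P ⟩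
  ⟨ (λ v → (Hz k g₁ (e₁ ∷ v) + Hz (suc k) g₁ v) - Hz k g₁₀ v) ∣ P ⟩ - ⟨ Hz-boundary k g e₁ ∣ P ⟩
    ≡⟨ cong (_- ⟨ Hz-boundary k g e₁ ∣ P ⟩) (⟨-∣⟩ _ (Hz k g₁₀) P) ⟩
  ⟨ (λ v → Hz k g₁ (e₁ ∷ v) + Hz (suc k) g₁ v) ∣ P ⟩ - ⟨ Hz k g₁₀ ∣ P ⟩ - ⟨ Hz-boundary k g e₁ ∣ P ⟩
    ≡⟨ cong (λ s → s - ⟨ Hz k g₁₀ ∣ P ⟩ - ⟨ Hz-boundary k g e₁ ∣ P ⟩)
            (⟨+∣⟩ (Hz k g₁ ∘ (e₁ ∷_)) (Hz (suc k) g₁) P) ⟩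
  ((⟨ Hz k g₁ ∘ (e₁ ∷_) ∣ P ⟩ + ⟨ Hz (suc k) g₁ ∣ P ⟩) - ⟨ Hz k g₁₀ ∣ P ⟩) - ⟨ Hz-boundary k g e₁ ∣ P ⟩
    ∎
  where
  g₁ g₁₀ : Word → ℚ
  g₁ = g ∘ (e₁ ∷_)
  g₁₀ = g₁ ∘ (e₀ ∷_)

H⋆e₁-suc : ∀ V n g → H⋆e₁ V (suc n) g ≡
  ((H⋆e₁ V n (g ∘ (e₁ ∷_)) + H⋆ V (suc n) (g ∘ (e₁ ∷_))) - H⋆ V n (g ∘ (e₁ ∷_) ∘ (e₀ ∷_)))
    - (⟨ g ∘ (e₁ ∷_) ∘ (e₀ ∷_) ∣ V n ⟩ - ⟨ g ∘ (e₁ ∷_) ∘ (e₁ ∷_) ∣ V n ⟩)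
H⋆e₁-suc V n g = begin
  H⋆e₁ V (suc n) g
    ≡⟨ ∑-suc-head n (λ k → ⟨ Hz k g ∘ (e₁ ∷_) ∣ V (suc n ∸ k) ⟩) ⟩
  ⟨ (λ _ → 0ℚ) ∣ V (suc n) ⟩ + ∑ n (λ k → ⟨ Hz (suc k) g ∘ (e₁ ∷_) ∣ V (n ∸ k) ⟩)
    ≡⟨ cong₂ _+_ (⟨0∣⟩ (V (suc n))) (∑-cong n (λ k _ → ⟨Hz∘e₁∷∣⟩-suc k g (V (n ∸ k)))) ⟩
  0ℚ + ∑ n (λ k → ((a k + b k) - c k) - d k)
    ≡⟨ ℚ.+-identityˡ _ ⟩
  ∑ n (λ k → ((a k + b k) - c k) - d k)
    ≡⟨ trans (∑-- n _ d) (cong (_- ∑ n d) (trans (∑-- n _ c) (cong (_- ∑ n c) (∑-+ n a b)))) ⟩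
  ((∑ n a + ∑ n b) - ∑ n c) - ∑ n d
    ≡⟨ cong₂ (λ s t → ((∑ n a + s) - ∑ n c) - t) ∑b ∑d ⟩
  ((H⋆e₁ V n g₁ + H⋆ V (suc n) g₁) - H⋆ V n g₁₀) - (⟨ g₁₀ ∣ V n ⟩ - ⟨ g₁₁ ∣ V n ⟩)
    ∎
  where
  g₁ g₁₀ g₁₁ : Word → ℚ
  g₁ = g ∘ (e₁ ∷_)
  g₁₀ = g₁ ∘ (e₀ ∷_)
  g₁₁ = g₁ ∘ (e₁ ∷_)
  a b c d : ℕ → ℚ
  a k = ⟨ Hz k g₁ ∘ (e₁ ∷_) ∣ V (n ∸ k) ⟩
  b k = ⟨ Hz (suc k) g₁ ∣ V (n ∸ k) ⟩
  c k = ⟨ Hz k g₁₀ ∣ V (n ∸ k) ⟩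
  d k = ⟨ Hz-boundary k g e₁ ∣ V (n ∸ k) ⟩
  ∑b : ∑ n b ≡ H⋆ V (suc n) g₁
  ∑b = sym (trans (∑-suc-head n (λ k → ⟨ Hz k g₁ ∣ V (suc n ∸ k) ⟩))
                  (trans (cong (_+ ∑ n b) (⟨0∣⟩ (V (suc n)))) (ℚ.+-identityˡ (∑ n b))))
  ∑d : ∑ n d ≡ ⟨ g₁₀ ∣ V n ⟩ - ⟨ g₁₁ ∣ V n ⟩
  ∑d = trans (∑-head-only n d (λ k → ⟨0∣⟩ (V (n ∸ suc k)))) (⟨-∣⟩ g₁₀ g₁₁ (V n))

-- The formula in e-coordinates

-- V = W + T(e₀ − e₁)V, that is V = (1 − φ(x)T)⁻¹ W: the relation between ΨX*σ w and Ψσ w.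
IsGeometricOver : Series → Series → Set
IsGeometricOver V W =
  V 0 ≗ₚ W 0 × (∀ j h → ⟨ h ∣ V (suc j) ⟩ ≡ ⟨ h ∣ W (suc j) ⟩ + (⟨ h ∘ (e₀ ∷_) ∣ V j ⟩ - ⟨ h ∘ (e₁ ∷_) ∣ V j ⟩))

ΨX*σ-geometric : ∀ w → IsGeometricOver (ΨX*σ w) (Ψσ w)
ΨX*σ-geometric w = ΨX*σ-zero w , ΨX*σ-suc w

H⋆-geometric : ∀ V W → IsGeometricOver V W →
  ∀ m h → H⋆ V (suc m) h ≡ H⋆ W (suc m) h + (H⋆ V m (h ∘ (e₀ ∷_)) - H⋆e₁ V m h)
H⋆-geometric V W (V₀≗W₀ , V-suc) m h = begin
  H⋆ V (suc m) h
    ≡⟨ ∑-antidiagonal-suc m (λ k j → ⟨ Hz k h ∣ V j ⟩) ⟩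
  ∑ m (λ k → ⟨ Hz k h ∣ V (suc (m ∸ k)) ⟩) + ⟨ Hz (suc m) h ∣ V 0 ⟩
    ≡⟨ cong₂ _+_ (∑-cong m (λ k _ → V-suc (m ∸ k) (Hz k h))) (V₀≗W₀ (Hz (suc m) h)) ⟩
  ∑ m (λ k → ⟨ Hz k h ∣ W (suc (m ∸ k)) ⟩ + d k) + ⟨ Hz (suc m) h ∣ W 0 ⟩
    ≡⟨ cong (_+ ⟨ Hz (suc m) h ∣ W 0 ⟩) (∑-+ m _ d) ⟩
  (∑ m (λ k → ⟨ Hz k h ∣ W (suc (m ∸ k)) ⟩) + ∑ m d) + ⟨ Hz (suc m) h ∣ W 0 ⟩
    ≡⟨ solve 3 (λ s t u → (s :+ t) :+ u := (s :+ u) :+ t) refl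
             (∑ m (λ k → ⟨ Hz k h ∣ W (suc (m ∸ k)) ⟩)) (∑ m d) ⟨ Hz (suc m) h ∣ W 0 ⟩ ⟩
  (∑ m (λ k → ⟨ Hz k h ∣ W (suc (m ∸ k)) ⟩) + ⟨ Hz (suc m) h ∣ W 0 ⟩) + ∑ m d
    ≡⟨ cong₂ _+_ (sym (∑-antidiagonal-suc m (λ k j → ⟨ Hz k h ∣ W j ⟩))) (∑-Hz∘e₀∷-Hz∘e₁∷ V m h) ⟩
  H⋆ W (suc m) h + (H⋆ V m (h ∘ (e₀ ∷_)) - H⋆e₁ V m h)
    ∎
  where
  d : ℕ → ℚ
  d k = ⟨ Hz k h ∘ (e₀ ∷_) ∣ V (m ∸ k) ⟩ - ⟨ Hz k h ∘ (e₁ ∷_) ∣ V (m ∸ k) ⟩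

H⋆e₁-geometric : ∀ V W → IsGeometricOver V W →
  ∀ n g → ⟨ g ∘ (e₁ ∷_) ∣ W n ⟩ + H⋆ W n (g ∘ (e₁ ∷_)) ≡ ⟨ g ∘ (e₁ ∷_) ∣ V n ⟩ + H⋆e₁ V n g
H⋆e₁-geometric V W (V₀≗W₀ , _) zero g = begin
  ⟨ g ∘ (e₁ ∷_) ∣ W 0 ⟩ + H⋆ W 0 (g ∘ (e₁ ∷_))
                                                  ≡⟨ cong₂ _+_ (sym (V₀≗W₀ (g ∘ (e₁ ∷_)))) (H⋆-zero W (g ∘ (e₁ ∷_))) ⟩
  ⟨ g ∘ (e₁ ∷_) ∣ V 0 ⟩ + 0ℚ                      ≡⟨ cong (⟨ g ∘ (e₁ ∷_) ∣ V 0 ⟩ +_) (sym (H⋆e₁-zero V g)) ⟩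
  ⟨ g ∘ (e₁ ∷_) ∣ V 0 ⟩ + H⋆e₁ V 0 g              ∎
H⋆e₁-geometric V W geo@(_ , V-suc) (suc m) g = sym (begin
  ⟨ g₁ ∣ V (suc m) ⟩ + H⋆e₁ V (suc m) g
    ≡⟨ cong₂ _+_ (V-suc m g₁) (H⋆e₁-suc V m g) ⟩
  (w + (v₁₀ - v₁₁)) + (((t + H⋆ V (suc m) g₁) - n₁₀) - (v₁₀ - v₁₁))
    ≡⟨ cong (λ s → (w + (v₁₀ - v₁₁)) + (((t + s) - n₁₀) - (v₁₀ - v₁₁))) (H⋆-geometric V W geo m g₁) ⟩
  (w + (v₁₀ - v₁₁)) + (((t + (H⋆ W (suc m) g₁ + (n₁₀ - t))) - n₁₀) - (v₁₀ - v₁₁))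
    ≡⟨ solve 6 (λ w v₁₀ v₁₁ t s n₁₀ →
                  (w :+ (v₁₀ :- v₁₁)) :+ (((t :+ (s :+ (n₁₀ :- t))) :- n₁₀) :- (v₁₀ :- v₁₁)) := w :+ s)
             refl w v₁₀ v₁₁ t (H⋆ W (suc m) g₁) n₁₀ ⟩
  ⟨ g₁ ∣ W (suc m) ⟩ + H⋆ W (suc m) g₁
    ∎)
  where
  g₁ : Word → ℚ
  g₁ = g ∘ (e₁ ∷_)
  w v₁₀ v₁₁ t n₁₀ : ℚ
  w = ⟨ g₁ ∣ W (suc m) ⟩
  v₁₀ = ⟨ g₁ ∘ (e₀ ∷_) ∣ V m ⟩
  v₁₁ = ⟨ g₁ ∘ (e₁ ∷_) ∣ V m ⟩
  t = H⋆e₁ V m g₁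
  n₁₀ = H⋆ V m (g₁ ∘ (e₀ ∷_))

BarFormula : Word → Set
BarFormula w = ∀ n g → ⟨ g ∣ Ψσbar w n ⟩ ≡ ⟨ g ∣ Ψσ w n ⟩ + H⋆ (Ψσ w) n g

bar-formula-[] : BarFormula []
bar-formula-[] n g = begin
  ⟨ g ∣ Ψσbar [] n ⟩                        ≡⟨ Ψσbar-[] n g ⟩
  ⟨ g ∣ Ψσ [] n ⟩                           ≡⟨ sym (ℚ.+-identityʳ _) ⟩
  ⟨ g ∣ Ψσ [] n ⟩ + 0ℚ                      ≡⟨ cong (⟨ g ∣ Ψσ [] n ⟩ +_) (sym (H⋆-Ψσ-[] n g)) ⟩
  ⟨ g ∣ Ψσ [] n ⟩ + H⋆ (Ψσ []) n g           ∎

bar-formula-Y∷ : ∀ w → BarFormula w → BarFormula (Y ∷ w)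
bar-formula-Y∷ w ih n g = begin
  ⟨ g ∣ Ψσbar (Y ∷ w) n ⟩                                     ≡⟨ Ψσbar-Y∷ w n g ⟩
  ⟨ g ∘ (e₁ ∷_) ∣ Ψσbar w n ⟩                                 ≡⟨ ih n (g ∘ (e₁ ∷_)) ⟩
  ⟨ g ∘ (e₁ ∷_) ∣ Ψσ w n ⟩ + H⋆ (Ψσ w) n (g ∘ (e₁ ∷_))
                                                              ≡⟨ H⋆e₁-geometric (ΨX*σ w) (Ψσ w) (ΨX*σ-geometric w) n g ⟩
  ⟨ g ∘ (e₁ ∷_) ∣ ΨX*σ w n ⟩ + H⋆e₁ (ΨX*σ w) n g              ≡⟨ sym (cong₂ _+_ (Ψσ-Y∷ w n g) (H⋆-Ψσ-Y∷ w n g)) ⟩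
  ⟨ g ∣ Ψσ (Y ∷ w) n ⟩ + H⋆ (Ψσ (Y ∷ w)) n g                  ∎

Ψσbar-X∷-unfold : ∀ w → BarFormula w → ∀ n g → ⟨ g ∣ Ψσbar (X ∷ w) n ⟩ ≡
  (⟨ g ∘ (e₀ ∷_) ∣ Ψσ w n ⟩ - ⟨ g ∘ (e₁ ∷_) ∣ Ψσ w n ⟩) + (H⋆ (Ψσ w) n (g ∘ (e₀ ∷_)) - H⋆e₁ (Ψσ w) n g)
Ψσbar-X∷-unfold w ih zero g = begin
  ⟨ g ∣ Ψσbar (X ∷ w) 0 ⟩
    ≡⟨ Ψσbar-X∷-zero w g ⟩
  ⟨ g₀ ∣ Ψσbar w 0 ⟩ - ⟨ g₁ ∣ Ψσbar w 0 ⟩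
    ≡⟨ cong₂ _-_ (trans (ih 0 g₀) (cong (a₀ +_) (H⋆-zero A g₀))) (trans (ih 0 g₁) (cong (a₁ +_) (H⋆-zero A g₁))) ⟩
  (a₀ + 0ℚ) - (a₁ + 0ℚ)
    ≡⟨ solve 2 (λ a₀ a₁ → (a₀ :+ con 0ℚ) :- (a₁ :+ con 0ℚ) := (a₀ :- a₁) :+ (con 0ℚ :- con 0ℚ)) refl a₀ a₁ ⟩
  (a₀ - a₁) + (0ℚ - 0ℚ)
    ≡⟨ sym (cong₂ (λ s t → (a₀ - a₁) + (s - t)) (H⋆-zero A g₀) (H⋆e₁-zero A g)) ⟩
  (a₀ - a₁) + (H⋆ A 0 g₀ - H⋆e₁ A 0 g)
    ∎
  where
  A : Series
  A = Ψσ w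
  g₀ g₁ : Word → ℚ
  g₀ = g ∘ (e₀ ∷_)
  g₁ = g ∘ (e₁ ∷_)
  a₀ a₁ : ℚ
  a₀ = ⟨ g₀ ∣ A 0 ⟩
  a₁ = ⟨ g₁ ∣ A 0 ⟩
Ψσbar-X∷-unfold w ih (suc n) g = begin
  ⟨ g ∣ Ψσbar (X ∷ w) (suc n) ⟩
    ≡⟨ Ψσbar-X∷-suc w n g ⟩
  (⟨ g₀ ∣ Ψσbar w (suc n) ⟩ - ⟨ g₁ ∣ Ψσbar w (suc n) ⟩) + ⟨ g₁ ∣ Ψσbar (X ∷ w) n ⟩
    ≡⟨ cong₂ _+_ (cong₂ _-_ (ih (suc n) g₀) (ih (suc n) g₁)) (Ψσbar-X∷-unfold w ih n g₁) ⟩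
  ((a₀ + s₀) - (a₁ + s₁)) + ((a₁₀ - a₁₁) + (s₁₀ - t₁))
    ≡⟨ solve 8 (λ a₀ a₁ s₀ s₁ a₁₀ a₁₁ s₁₀ t₁ →
                ((a₀ :+ s₀) :- (a₁ :+ s₁)) :+ ((a₁₀ :- a₁₁) :+ (s₁₀ :- t₁)) :=
                (a₀ :- a₁) :+ (s₀ :- (((t₁ :+ s₁) :- s₁₀) :- (a₁₀ :- a₁₁))))
             refl a₀ a₁ s₀ s₁ a₁₀ a₁₁ s₁₀ t₁ ⟩
  (a₀ - a₁) + (s₀ - (((t₁ + s₁) - s₁₀) - (a₁₀ - a₁₁)))
    ≡⟨ cong (λ t → (a₀ - a₁) + (s₀ - t)) (sym (H⋆e₁-suc A n g)) ⟩
  (a₀ - a₁) + (s₀ - H⋆e₁ A (suc n) g)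
    ∎
  where
  A : Series
  A = Ψσ w
  g₀ g₁ : Word → ℚ
  g₀ = g ∘ (e₀ ∷_)
  g₁ = g ∘ (e₁ ∷_)
  a₀ a₁ s₀ s₁ a₁₀ a₁₁ s₁₀ t₁ : ℚ
  a₀ = ⟨ g₀ ∣ A (suc n) ⟩
  a₁ = ⟨ g₁ ∣ A (suc n) ⟩
  s₀ = H⋆ A (suc n) g₀
  s₁ = H⋆ A (suc n) g₁
  a₁₀ = ⟨ g₁ ∘ (e₀ ∷_) ∣ A n ⟩
  a₁₁ = ⟨ g₁ ∘ (e₁ ∷_) ∣ A n ⟩
  s₁₀ = H⋆ A n (g₁ ∘ (e₀ ∷_))
  t₁ = H⋆e₁ A n g₁

bar-formula-X∷ : ∀ w → BarFormula w → BarFormula (X ∷ w)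
bar-formula-X∷ w ih n g = begin
  ⟨ g ∣ Ψσbar (X ∷ w) n ⟩
    ≡⟨ Ψσbar-X∷-unfold w ih n g ⟩
  (⟨ g ∘ (e₀ ∷_) ∣ Ψσ w n ⟩ - ⟨ g ∘ (e₁ ∷_) ∣ Ψσ w n ⟩) + (H⋆ (Ψσ w) n (g ∘ (e₀ ∷_)) - H⋆e₁ (Ψσ w) n g)
    ≡⟨ sym (cong₂ _+_ (Ψσ-X∷ w n g) (H⋆-Ψσ-X∷ w n g)) ⟩
  ⟨ g ∣ Ψσ (X ∷ w) n ⟩ + H⋆ (Ψσ (X ∷ w)) n g
    ∎

bar-formula : ∀ w → BarFormula w
bar-formula [] = bar-formula-[]
bar-formula (X ∷ w) = bar-formula-X∷ w (bar-formula w)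
bar-formula (Y ∷ w) = bar-formula-Y∷ w (bar-formula w)

-- Back to x and y

φᵀ : (Word → ℚ) → Word → ℚ
φᵀ g t = ⟨ g ∣ φW t ⟩

⟨∣φ⟩ : ∀ g p → ⟨ g ∣ φ p ⟩ ≡ ⟨ φᵀ g ∣ p ⟩
⟨∣φ⟩ g = ⟨∣⟩-lin g φW

φᵀ-X∷ : ∀ g t → φᵀ g (X ∷ t) ≡ φᵀ (g ∘ (X ∷_)) t + φᵀ (g ∘ (Y ∷_)) t
φᵀ-X∷ g t = trans (⟨∣⟩-⊗ g (φL X) (φW t))
  (solve 2 (λ s u → con 1ℚ :* s :+ (con 1ℚ :* u :+ con 0ℚ) := s :+ u) refl
         (φᵀ (g ∘ (X ∷_)) t) (φᵀ (g ∘ (Y ∷_)) t))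

φᵀ-Y∷ : ∀ g t → φᵀ g (Y ∷ t) ≡ - φᵀ (g ∘ (Y ∷_)) t
φᵀ-Y∷ g t = trans (⟨∣⟩-⊗ g (φL Y) (φW t))
  (solve 1 (λ u → con (- 1ℚ) :* u :+ con 0ℚ := :- u) refl (φᵀ (g ∘ (Y ∷_)) t))

φᵀ-involutive : ∀ g t → φᵀ (φᵀ g) t ≡ g t
φᵀ-involutive g [] = trans (⟨∣⟩-singleton (φᵀ g) []) (⟨∣⟩-singleton g [])
φᵀ-involutive g (X ∷ t) = begin
  φᵀ (φᵀ g) (X ∷ t)
    ≡⟨ φᵀ-X∷ (φᵀ g) t ⟩
  φᵀ (φᵀ g ∘ (X ∷_)) t + φᵀ (φᵀ g ∘ (Y ∷_)) t
    ≡⟨ cong₂ _+_ (trans (⟨∣⟩-congˡ (φᵀ-X∷ g) (φW t)) (⟨+∣⟩ (φᵀ g₀) (φᵀ g₁) (φW t)))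
                 (trans (⟨∣⟩-congˡ (φᵀ-Y∷ g) (φW t)) (⟨neg∣⟩ (φᵀ g₁) (φW t))) ⟩
  (φᵀ (φᵀ g₀) t + φᵀ (φᵀ g₁) t) - φᵀ (φᵀ g₁) t
    ≡⟨ solve 2 (λ s u → (s :+ u) :- u := s) refl (φᵀ (φᵀ g₀) t) (φᵀ (φᵀ g₁) t) ⟩
  φᵀ (φᵀ g₀) t
    ≡⟨ φᵀ-involutive g₀ t ⟩
  g (X ∷ t)
    ∎
  where
  g₀ g₁ : Word → ℚ
  g₀ = g ∘ (X ∷_)
  g₁ = g ∘ (Y ∷_)
φᵀ-involutive g (Y ∷ t) = begin
  φᵀ (φᵀ g) (Y ∷ t)                 ≡⟨ φᵀ-Y∷ (φᵀ g) t ⟩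
  - φᵀ (φᵀ g ∘ (Y ∷_)) t            ≡⟨ cong -_ (trans (⟨∣⟩-congˡ (φᵀ-Y∷ g) (φW t)) (⟨neg∣⟩ _ (φW t))) ⟩
  - - φᵀ (φᵀ (g ∘ (Y ∷_))) t        ≡⟨ neg-involutive _ ⟩
  φᵀ (φᵀ (g ∘ (Y ∷_))) t            ≡⟨ φᵀ-involutive (g ∘ (Y ∷_)) t ⟩
  g (Y ∷ t)                         ∎

signed : (Word → ℚ) → Word → ℚ
signed h r = eSign r * h r

signed-involutive : ∀ h r → signed (signed h) r ≡ h r
signed-involutive h r =
  trans (sym (ℚ.*-assoc (eSign r) (eSign r) (h r))) (trans (cong (_* h r) (eSign² r)) (ℚ.*-identityˡ (h r)))
  where
  eSign² : ∀ r → eSign r * eSign r ≡ 1ℚ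
  eSign² [] = refl
  eSign² (X ∷ r) = eSign² r
  eSign² (Y ∷ r) = trans (solve 1 (λ e → (:- e) :* (:- e) := e :* e) refl (eSign r)) (eSign² r)

signed-Y∷ : ∀ h v → signed h (Y ∷ v) ≡ - signed (h ∘ (Y ∷_)) v
signed-Y∷ h v = sym (ℚ.neg-distribˡ-* (eSign v) (h (Y ∷ v)))

Ψᵀ≡φᵀ∘signed : ∀ h t → Ψᵀ h t ≡ φᵀ (signed h) t
Ψᵀ≡φᵀ∘signed h [] = trans (⟨∣⟩-singleton h []) (sym (trans (⟨∣⟩-singleton (signed h) []) (ℚ.*-identityˡ (h []))))
Ψᵀ≡φᵀ∘signed h (X ∷ t) = begin
  Ψᵀ h (X ∷ t)                                      ≡⟨ Ψᵀ-X∷ h t ⟩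
  Ψᵀ (h ∘ (e₀ ∷_)) t - Ψᵀ (h ∘ (e₁ ∷_)) t
    ≡⟨ cong₂ _-_ (Ψᵀ≡φᵀ∘signed (h ∘ (e₀ ∷_)) t) (Ψᵀ≡φᵀ∘signed (h ∘ (e₁ ∷_)) t) ⟩
  φᵀ (signed (h ∘ (X ∷_))) t - φᵀ (signed (h ∘ (Y ∷_))) t
    ≡⟨ cong (φᵀ (signed (h ∘ (X ∷_))) t +_)
            (sym (trans (⟨∣⟩-congˡ (signed-Y∷ h) (φW t)) (⟨neg∣⟩ (signed (h ∘ (Y ∷_))) (φW t)))) ⟩
  φᵀ (signed h ∘ (X ∷_)) t + φᵀ (signed h ∘ (Y ∷_)) t  ≡⟨ sym (φᵀ-X∷ (signed h) t) ⟩
  φᵀ (signed h) (X ∷ t)                              ∎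
Ψᵀ≡φᵀ∘signed h (Y ∷ t) = begin
  Ψᵀ h (Y ∷ t)                       ≡⟨ Ψᵀ-Y∷ h t ⟩
  Ψᵀ (h ∘ (Y ∷_)) t                  ≡⟨ Ψᵀ≡φᵀ∘signed (h ∘ (Y ∷_)) t ⟩
  φᵀ (signed (h ∘ (Y ∷_))) t         ≡⟨ sym (neg-involutive _) ⟩
  - - φᵀ (signed (h ∘ (Y ∷_))) t     ≡⟨ cong -_ (sym (trans (⟨∣⟩-congˡ (signed-Y∷ h) (φW t)) (⟨neg∣⟩ _ (φW t)))) ⟩
  - φᵀ (signed h ∘ (Y ∷_)) t         ≡⟨ sym (φᵀ-Y∷ (signed h) t) ⟩
  φᵀ (signed h) (Y ∷ t)              ∎

⟨∣⟩-via-Ψ : ∀ g p → ⟨ g ∣ p ⟩ ≡ ⟨ signed (φᵀ g) ∣ Ψ p ⟩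
⟨∣⟩-via-Ψ g p = sym (begin
  ⟨ signed (φᵀ g) ∣ Ψ p ⟩                 ≡⟨ ⟨∣Ψ⟩ (signed (φᵀ g)) p ⟩
  ⟨ Ψᵀ (signed (φᵀ g)) ∣ p ⟩              ≡⟨ ⟨∣⟩-congˡ (Ψᵀ≡φᵀ∘signed (signed (φᵀ g))) p ⟩
  ⟨ φᵀ (signed (signed (φᵀ g))) ∣ p ⟩     ≡⟨ ⟨∣⟩-congˡ (λ t → ⟨∣⟩-congˡ (signed-involutive (φᵀ g)) (φW t)) p ⟩
  ⟨ φᵀ (φᵀ g) ∣ p ⟩                       ≡⟨ ⟨∣⟩-congˡ (φᵀ-involutive g) p ⟩
  ⟨ g ∣ p ⟩                               ∎)

⟨∣⊛̃⟩ : ∀ g p q → ⟨ g ∣ p ⊛̃ q ⟩ ≡ ⟨ (λ r → ⟨ (λ v → ⟨ g ∣ hW r v ⟩) ∣ q ⟩) ∣ p ⟩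
⟨∣⊛̃⟩ g p q = ⟨∣⟩-concatMap g _ _ row p
  where
  row : ∀ a r → ⟨ g ∣ concatMap (λ { (b , v) → scale (a * b) (hW r v) }) q ⟩ ≡ a * ⟨ (λ v → ⟨ g ∣ hW r v ⟩) ∣ q ⟩
  row a r = trans (⟨∣⟩-concatMap g _ (λ v → a * ⟨ g ∣ hW r v ⟩) entry q) (⟨*∣⟩ a (λ v → ⟨ g ∣ hW r v ⟩) q)
    where
    entry : ∀ b v → ⟨ g ∣ scale (a * b) (hW r v) ⟩ ≡ b * (a * ⟨ g ∣ hW r v ⟩)
    entry b v = trans (⟨∣⟩-scale g (a * b) (hW r v))
                      (solve 3 (λ a b s → (a :* b) :* s := b :* (a :* s)) refl a b ⟨ g ∣ hW r v ⟩)

⟨∣hW⟩ : ∀ h u v → ⟨ h ∣ hW u v ⟩ ≡ (eSign u * eSign v) * ⟨ signed h ∣ hE u v ⟩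
⟨∣hW⟩ h u v = begin
  ⟨ h ∣ hW u v ⟩
    ≡⟨ ⟨∣⟩-lin h (λ r → (eSign r , r) ∷ []) (scale c (hE u v)) ⟩
  ⟨ (λ r → ⟨ h ∣ (eSign r , r) ∷ [] ⟩) ∣ scale c (hE u v) ⟩
    ≡⟨ ⟨∣⟩-scale _ c (hE u v) ⟩
  c * ⟨ (λ r → ⟨ h ∣ (eSign r , r) ∷ [] ⟩) ∣ hE u v ⟩
    ≡⟨ cong (c *_) (⟨∣⟩-congˡ (λ r → ℚ.+-identityʳ (signed h r)) (hE u v)) ⟩
  c * ⟨ signed h ∣ hE u v ⟩
    ∎
  where
  c : ℚ
  c = eSign u * eSign v

⟨∣yTz⟩-hW : ∀ h k v → ⟨ (λ r → ⟨ h ∣ hW r v ⟩) ∣ yTz k ⟩ ≡ signed (Hz k (signed h)) v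
⟨∣yTz⟩-hW h zero v = sym (ℚ.*-zeroʳ (eSign v))
⟨∣yTz⟩-hW h (suc j) v = begin
  s * ⟨ h ∣ hW (w e₀) v ⟩ + (s * ⟨ h ∣ hW (w e₁) v ⟩ + 0ℚ)
    ≡⟨ cong₂ (λ a b → s * a + (s * b + 0ℚ)) (⟨∣hW⟩ h (w e₀) v) (⟨∣hW⟩ h (w e₁) v) ⟩
  s * ((eSign (w e₀) * eSign v) * z₀) + (s * ((eSign (w e₁) * eSign v) * z₁) + 0ℚ)
    ≡⟨ cong₂ (λ a b → s * ((a * eSign v) * z₀) + (s * ((b * eSign v) * z₁) + 0ℚ))
             (eSign-e₁ʲ (suc j) (e₀ ∷ [])) (eSign-e₁ʲ (suc j) (e₁ ∷ [])) ⟩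
  s * (((- s) * 1ℚ * eSign v) * z₀) + (s * (((- s) * (- 1ℚ) * eSign v) * z₁) + 0ℚ)
    ≡⟨ solve 4 (λ s e z₀ z₁ →
                  s :* (((:- s) :* con 1ℚ :* e) :* z₀) :+ (s :* (((:- s) :* (:- con 1ℚ) :* e) :* z₁) :+ con 0ℚ)
                  := (s :* s) :* (e :* (z₁ :- z₀)))
             refl s (eSign v) z₀ z₁ ⟩
  (s * s) * (eSign v * (z₁ - z₀))
    ≡⟨ trans (cong (_* (eSign v * (z₁ - z₀))) (sgnPow² j)) (ℚ.*-identityˡ _) ⟩
  eSign v * (z₁ - z₀)
    ∎
  where
  s : ℚ
  s = sgnPow j
  w : Bool → Word
  w c = replicate (suc j) e₁ ∷ʳ c
  z₀ z₁ : ℚ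
  z₀ = ⟨ signed h ∣ hE (w e₀) v ⟩
  z₁ = ⟨ signed h ∣ hE (w e₁) v ⟩
  eSign-e₁ʲ : ∀ m u → eSign (replicate m e₁ ++ u) ≡ sgnPow m * eSign u
  eSign-e₁ʲ zero u = sym (ℚ.*-identityˡ (eSign u))
  eSign-e₁ʲ (suc m) u = trans (cong -_ (eSign-e₁ʲ m u)) (ℚ.neg-distribˡ-* (sgnPow m) (eSign u))
  sgnPow² : ∀ j → sgnPow j * sgnPow j ≡ 1ℚ
  sgnPow² zero = refl
  sgnPow² (suc j) = trans (solve 1 (λ e → (:- e) :* (:- e) := e :* e) refl (sgnPow j)) (sgnPow² j)

⟨φᵀ∣yTz⊛̃φ⟩ : ∀ g k p → ⟨ φᵀ g ∣ yTz k ⊛̃ φ p ⟩ ≡ ⟨ Hz k (signed (φᵀ g)) ∣ Ψ p ⟩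
⟨φᵀ∣yTz⊛̃φ⟩ g k p = begin
  ⟨ φᵀ g ∣ yTz k ⊛̃ φ p ⟩
    ≡⟨ ⟨∣⊛̃⟩ (φᵀ g) (yTz k) (φ p) ⟩
  ⟨ (λ r → ⟨ (λ v → ⟨ φᵀ g ∣ hW r v ⟩) ∣ φ p ⟩) ∣ yTz k ⟩
    ≡⟨ ⟨∣⟩-swap (λ r v → ⟨ φᵀ g ∣ hW r v ⟩) (yTz k) (φ p) ⟩
  ⟨ (λ v → ⟨ (λ r → ⟨ φᵀ g ∣ hW r v ⟩) ∣ yTz k ⟩) ∣ φ p ⟩
    ≡⟨ ⟨∣⟩-congˡ (⟨∣yTz⟩-hW (φᵀ g) k) (φ p) ⟩
  ⟨ signed G ∣ φ p ⟩
    ≡⟨ ⟨∣φ⟩ (signed G) p ⟩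
  ⟨ φᵀ (signed G) ∣ p ⟩
    ≡⟨ sym (⟨∣⟩-congˡ (Ψᵀ≡φᵀ∘signed G) p) ⟩
  ⟨ Ψᵀ G ∣ p ⟩
    ≡⟨ sym (⟨∣Ψ⟩ G p) ⟩
  ⟨ G ∣ Ψ p ⟩
    ∎
  where
  G : Word → ℚ
  G = Hz k (signed (φᵀ g))

⟨∣σbar⟩ : ∀ g w n → ⟨ g ∣ σbar w n ⟩ ≡ ⟨ (λ u → ⟨ g ∣ σbarW u n ⟩) ∣ w ⟩
⟨∣σbar⟩ g w n = begin
  ⟨ g ∣ τ (σ (τ w) n) ⟩                       ≡⟨ ⟨∣τ⟩ g (σ (τ w) n) ⟩
  ⟨ g ∘ τW ∣ σ (τ w) n ⟩                      ≡⟨ ⟨∣⟩-lin (g ∘ τW) (λ u → σW u n) (τ w) ⟩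
  ⟨ (λ u → ⟨ g ∘ τW ∣ σW u n ⟩) ∣ τ w ⟩       ≡⟨ ⟨∣τ⟩ (λ u → ⟨ g ∘ τW ∣ σW u n ⟩) w ⟩
  ⟨ (λ u → ⟨ g ∘ τW ∣ σW (τW u) n ⟩) ∣ w ⟩    ≡⟨ ⟨∣⟩-congˡ (λ u → sym (⟨∣τ⟩ g (σW (τW u) n))) w ⟩
  ⟨ (λ u → ⟨ g ∣ σbarW u n ⟩) ∣ w ⟩           ∎

⟨∣Ψσ⟩ : ∀ h w m → ⟨ h ∣ Ψ (σ w m) ⟩ ≡ ⟨ (λ u → ⟨ h ∣ Ψσ u m ⟩) ∣ w ⟩
⟨∣Ψσ⟩ h w m = begin
  ⟨ h ∣ Ψ (σ w m) ⟩                            ≡⟨ ⟨∣Ψ⟩ h (σ w m) ⟩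
  ⟨ Ψᵀ h ∣ σ w m ⟩                             ≡⟨ ⟨∣⟩-lin (Ψᵀ h) (λ u → σW u m) w ⟩
  ⟨ (λ u → ⟨ Ψᵀ h ∣ σW u m ⟩) ∣ w ⟩            ≡⟨ ⟨∣⟩-congˡ (λ u → sym (⟨∣Ψ⟩ h (σW u m))) w ⟩
  ⟨ (λ u → ⟨ h ∣ Ψσ u m ⟩) ∣ w ⟩               ∎

⟨∣φ[yTz⊛̃φσ]⟩ : ∀ g w n → ⟨ g ∣ φS (yTz ⊛̃S φS (σ w)) n ⟩ ≡ ⟨ (λ u → H⋆ (Ψσ u) n (signed (φᵀ g))) ∣ w ⟩
⟨∣φ[yTz⊛̃φσ]⟩ g w n = begin
  ⟨ g ∣ φ (sumUpTo n (λ k → yTz k ⊛̃ φ (σ w (n ∸ k)))) ⟩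
    ≡⟨ trans (⟨∣φ⟩ g (sumUpTo n T)) (⟨∣⟩-sumUpTo (φᵀ g) n T) ⟩
  ∑ n (λ k → ⟨ φᵀ g ∣ yTz k ⊛̃ φ (σ w (n ∸ k)) ⟩)
    ≡⟨ ∑-cong n (λ k _ → trans (⟨φᵀ∣yTz⊛̃φ⟩ g k (σ w (n ∸ k))) (⟨∣Ψσ⟩ (Hz k G) w (n ∸ k))) ⟩
  ∑ n (λ k → ⟨ (λ u → ⟨ Hz k G ∣ Ψσ u (n ∸ k) ⟩) ∣ w ⟩)
    ≡⟨ sym (⟨∑∣⟩ n (λ k u → ⟨ Hz k G ∣ Ψσ u (n ∸ k) ⟩) w) ⟩
  ⟨ (λ u → H⋆ (Ψσ u) n G) ∣ w ⟩
    ∎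
  where
  G : Word → ℚ
  G = signed (φᵀ g)
  T : ℕ → Poly
  T k = yTz k ⊛̃ φ (σ w (n ∸ k))

proposition4p1 : (w : Poly) → coeff w [] ≡ 0ℚ →
    ∀ n → σbar w n ≈ (σ w ⊕S φS (yTz ⊛̃S φS (σ w))) n
-- The hypothesis w ∈ 𝔥' is unused: hE vanishes on the empty word, so the identity also holds for constants.
proposition4p1 w _ n = ≗ₚ⇒≈ {σbar w n} {rhs} pairings
  where
  rhs : Poly
  rhs = (σ w ⊕S φS (yTz ⊛̃S φS (σ w))) n
  pairings : σbar w n ≗ₚ rhs
  pairings g = begin
    ⟨ g ∣ σbar w n ⟩
      ≡⟨ ⟨∣σbar⟩ g w n ⟩
    ⟨ (λ u → ⟨ g ∣ σbarW u n ⟩) ∣ w ⟩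
      ≡⟨ ⟨∣⟩-congˡ (λ u → trans (⟨∣⟩-via-Ψ g (σbarW u n)) (bar-formula u n G)) w ⟩
    ⟨ (λ u → ⟨ G ∣ Ψσ u n ⟩ + H⋆ (Ψσ u) n G) ∣ w ⟩
      ≡⟨ ⟨+∣⟩ (λ u → ⟨ G ∣ Ψσ u n ⟩) (λ u → H⋆ (Ψσ u) n G) w ⟩
    ⟨ (λ u → ⟨ G ∣ Ψσ u n ⟩) ∣ w ⟩ + ⟨ (λ u → H⋆ (Ψσ u) n G) ∣ w ⟩
      ≡⟨ cong₂ _+_ (trans (⟨∣⟩-congˡ (λ u → sym (⟨∣⟩-via-Ψ g (σW u n))) w) (sym (⟨∣⟩-lin g (λ u → σW u n) w)))
                   (sym (⟨∣φ[yTz⊛̃φσ]⟩ g w n)) ⟩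
    ⟨ g ∣ σ w n ⟩ + ⟨ g ∣ φS (yTz ⊛̃S φS (σ w)) n ⟩
      ≡⟨ sym (⟨∣⟩-++ g (σ w n) _) ⟩
    ⟨ g ∣ rhs ⟩
      ∎
    where
    G : Word → ℚ
    G = signed (φᵀ g)
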